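{- Let $G$ be a cubic graph and $M\subseteq E(G)$, and let $G'$ be the graph obtained from $G$ by attaching a co-fish to every edge of $M$. Then $(G,M)$ admits a valid decomposition if and only if $G'$ admits a $\{K_{1,3},P_4\}$-decomposition.
   Context: All graphs are finite, simple, connected and nontrivial. A graph is cubic if every vertex has degree $3$. $K_{1,3}$ is the star with three edges, $K_3$ the triangle, and $P_4$ the path on four vertices (three edges); the middle edge of a $P_4$ is the edge joining its two inner vertices. For a set $S'$ of graphs, an $S'$-decomposition of $H$ is a partition of $E(H)$ into subgraphs each isomorphic to a graph in $S'$. For $N\subseteq E(H)$, a valid decomposition of $(H,N)$ is a $\{K_{1,3},K_3,P_4\}$-decomposition $D$ of $H$ such that no edge of $N$ is the middle edge of a $P_4$ in $D$ and every $K_3$ in $D$ has exactly one or exactly two edges in $N$. The co-fish is the graph with vertices $a,b,c,d,e,f$ and edges $ab,af,ad,bc,be,cd,ce,de$ (so $f$ is its unique vertex of degree $1$). Attaching a co-fish to an edge $uv$ means: subdivide $uv$ by a new vertex $w$ (replacing $uv$ by $uw$ and $wv$), and add a new copy of the co-fish in which the vertex $f$ is identified with $w$; for distinct edges of $M$ distinct new vertices and distinct copies are used. -}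

module Defs where

open import Data.Nat using (ℕ)
open import Data.Fin using (Fin)
open import Data.Bool using (Bool; T)
open import Data.Product using (Σ; _×_; _,_; proj₁; proj₂)
open import Data.Sum using (_⊎_; inj₁; inj₂)
open import Data.Unit using (⊤)
open import Data.Empty using (⊥)
open import Data.List using (List; []; _∷_)
open import Data.List.Relation.Unary.Any using (Any)
open import Data.List.Relation.Unary.All using (All)
open import Data.List.Relation.Unary.AllPairs using (AllPairs)
open import Relation.Nullary using (¬_)
open import Relation.Binary.PropositionalEquality using (_≡_; _≢_)

-- Generic (simple) graphs: vertex type V, edge relation E (assumed
-- symmetric and irreflexive where graphs are introduced).

-- the ordered pair (a , b) represents the unordered edge {u,v}
SameEdge : {V : Set} → V × V → V → V → Set
SameEdge (a , b) u v = (a ≡ u × b ≡ v) ⊎ (a ≡ v × b ≡ u)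

data Reach {V : Set} (E : V → V → Set) (u : V) : V → Set where
  here : Reach E u u
  step : ∀ {v w} → Reach E u v → E v w → Reach E u w

Connected : {V : Set} → (V → V → Set) → Set
Connected {V} E = (u v : V) → Reach E u v

Cubic : {V : Set} → (V → V → Set) → Set
Cubic {V} E = (v : V) → Σ V λ x → Σ V λ y → Σ V λ z →
  (x ≢ y × y ≢ z × x ≢ z) × (E v x × E v y × E v z) ×
  ((u : V) → E v u → (u ≡ x ⊎ u ≡ y ⊎ u ≡ z))

data Piece (V : Set) : Set where
  star : V → V → V → V → Piece V
  tri  : V → V → V → Piece V
  path : V → V → V → V → Piece V

verts : {V : Set} → Piece V → List V
verts (star c x y z) = c ∷ x ∷ y ∷ z ∷ []
verts (tri x y z)    = x ∷ y ∷ z ∷ []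
verts (path w x y z) = w ∷ x ∷ y ∷ z ∷ []

edges : {V : Set} → Piece V → List (V × V)
edges (star c x y z) = (c , x) ∷ (c , y) ∷ (c , z) ∷ []
edges (tri x y z)    = (x , y) ∷ (y , z) ∷ (z , x) ∷ []
edges (path w x y z) = (w , x) ∷ (x , y) ∷ (y , z) ∷ []

Covers : {V : Set} → Piece V → V → V → Set
Covers p u v = Any (λ e → SameEdge e u v) (edges p)

record Decomposition (V : Set) (E : V → V → Set) : Set where
  field
    size        : ℕ
    piece       : Fin size → Piece V
    distinct    : (i : Fin size) → AllPairs _≢_ (verts (piece i))
    inE         : (i : Fin size) → All (λ e → E (proj₁ e) (proj₂ e)) (edges (piece i))
    exactlyOnce : (u v : V) → E u v →
      Σ (Fin size) λ i → Covers (piece i) u v ×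
        ((j : Fin size) → Covers (piece j) u v → j ≡ i)
open Decomposition public

ValidPiece : {V : Set} → (V → V → Set) → Piece V → Set
ValidPiece N (star c x y z) = ⊤
ValidPiece N (path w x y z) = ¬ N x y
ValidPiece N (tri x y z)    =
  (N x y ⊎ N y z ⊎ N z x) × ¬ (N x y × N y z × N z x)

HasValidDecomposition : (V : Set) → (V → V → Set) → (V → V → Set) → Set
HasValidDecomposition V E N =
  Σ (Decomposition V E) λ D → (i : Fin (size D)) → ValidPiece N (piece D i)

NotTri : {V : Set} → Piece V → Set
NotTri (tri x y z) = ⊥
NotTri _           = ⊤

HasStarPathDecomposition : (V : Set) → (V → V → Set) → Set
HasStarPathDecomposition V E =
  Σ (Decomposition V E) λ D → (i : Fin (size D)) → NotTri (piece D i)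

EG : {n : ℕ} → (Fin n → Fin n → Bool) → Fin n → Fin n → Set
EG adj u v = T (adj u v)

-- the edge set M, given as an indexing Fin m → Fin n × Fin n
MEdge : {n m : ℕ} → (Fin m → Fin n × Fin n) → Fin n → Fin n → Set
MEdge {m = m} M u v = Σ (Fin m) λ i → SameEdge (M i) u v

data CoFish : Set where
  a b c d e f : CoFish

data CoE : CoFish → CoFish → Set where
  ab : CoE a b
  af : CoE a f
  ad : CoE a d
  bc : CoE b c
  be : CoE b e
  cd : CoE c d
  ce : CoE c e
  de : CoE d e

CoAdj : CoFish → CoFish → Set
CoAdj x y = CoE x y ⊎ CoE y x

-- vertices of G': old vertices, and for each i : Fin m a copy of the
-- co-fish (whose vertex f is the subdivision vertex w_i of edge M i)
AttV : ℕ → ℕ → Set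
AttV n m = Fin n ⊎ (Fin m × CoFish)

data AttE {n m : ℕ} (adj : Fin n → Fin n → Bool) (M : Fin m → Fin n × Fin n)
  : AttV n m → AttV n m → Set where
  old   : ∀ {u v} → T (adj u v) → ((i : Fin m) → ¬ SameEdge (M i) u v) →
          AttE adj M (inj₁ u) (inj₁ v)
  subˡ  : (i : Fin m) → AttE adj M (inj₁ (proj₁ (M i))) (inj₂ (i , f))
  subˡ' : (i : Fin m) → AttE adj M (inj₂ (i , f)) (inj₁ (proj₁ (M i)))
  subʳ  : (i : Fin m) → AttE adj M (inj₂ (i , f)) (inj₁ (proj₂ (M i)))
  subʳ' : (i : Fin m) → AttE adj M (inj₁ (proj₂ (M i))) (inj₂ (i , f))
  fish  : (i : Fin m) {x y : CoFish} → CoAdj x y →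
          AttE adj M (inj₂ (i , x)) (inj₂ (i , y))

-- Seen from inside one co-fish, a {K₁,₃,P₄}-decomposition of G′ is so constrained (an exhaustive
-- check) that the edge af is always the middle edge of a path t–f–a–(b or d), t an end of the
-- subdivided edge. Every other piece either stays inside one gadget or has each of its edges at an
-- old vertex, using at most one subdivision edge per gadget. Contracting the gadgets maps the
-- latter pieces to stars, to paths whose middle edge is not in M, and, when both ends of a path
-- collapse onto one vertex, to triangles with one or two edges in M. Conversely, a valid
-- decomposition of (G,M) is expanded by routing each edge of M through its subdivision vertex,
-- which opens every triangle into a path; the rest of each gadget splits into the path t–f–a–d,
-- the path a–b–c–d and the star at e.

module Submission where

open import Defs
open import Data.Nat as ℕ using (ℕ; zero; suc; _+_; _*_)
open import Data.Fin as Fin using (Fin)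
open import Data.Fin.Properties as Finₚ using (+↔⊎; *↔×; 0↔⊥; 1↔⊤)
open import Data.Bool using (Bool; true; false; T; not; _∧_; _∨_; if_then_else_)
open import Data.Bool.ListAction using (all)
open import Data.Bool.Properties using (T-∧; T-∨; T?; T-irrelevant)
open import Data.Product using (Σ; _×_; _,_; proj₁; proj₂)
open import Data.Product.Properties using (Σ-≡,≡→≡) renaming (≡-dec to ×-≡-dec)
open import Data.Product.Function.NonDependent.Propositional using (_×-↔_)
open import Data.Sum using (_⊎_; inj₁; inj₂; [_,_]′)
open import Data.Sum.Properties using (inj₁-injective)
open import Data.Sum.Function.Propositional using (_⊎-↔_)
open import Data.Unit using (⊤; tt)
open import Data.Empty using (⊥; ⊥-elim)
open import Data.Maybe using (Maybe; just; nothing; is-nothing)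
open import Data.Maybe.Properties using (just-injective)
open import Data.List using (List; []; _∷_; map; filter; filterᵇ; head)
import Data.List.Properties as Listₚ
open import Data.List.Relation.Unary.Any as Any using (Any; here; there; any?)
import Data.List.Relation.Unary.Any.Properties as Anyₚ
open import Data.List.Relation.Unary.All as All using (All; []; _∷_; all?)
open import Data.List.Relation.Unary.All.Properties as Allₚ using (all⁺; all⁻)
open import Data.List.Relation.Unary.AllPairs as AllPairs using (AllPairs; []; _∷_; allPairs?)
import Data.List.Relation.Unary.AllPairs.Properties as AllPairsₚ
open import Data.List.Membership.Propositional using (_∈_)
open import Data.List.Membership.Propositional.Properties using (∈-filter⁺; ∈-filter⁻)
import Data.List.Membership.DecPropositional as DecMembership
open import Function.Base using (_∘_; _∘′_; case_of_)
open import Function.Bundles using (_⇔_; mk⇔; _↔_; mk↔ₛ′; Inverse; Equivalence)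
open import Function.Properties.Inverse using (↔-refl; ↔-trans)
open import Relation.Nullary using (Dec; yes; no; ¬_; ¬?; map′)
open import Relation.Nullary.Decidable using (⌊_⌋; toWitness; fromWitness; _×-dec_; _⊎-dec_)
open import Relation.Binary.Definitions using (DecidableEquality)
open import Relation.Binary.PropositionalEquality

SameEdge-sym : {V : Set} {ε : V × V} {u v : V} → SameEdge ε u v → SameEdge ε v u
SameEdge-sym (inj₁ (p , q)) = inj₂ (p , q)
SameEdge-sym (inj₂ (p , q)) = inj₁ (p , q)

SameEdge-swap : {V : Set} {s t u v : V} → SameEdge (s , t) u v → SameEdge (t , s) u v
SameEdge-swap (inj₁ (p , q)) = inj₂ (q , p)
SameEdge-swap (inj₂ (p , q)) = inj₁ (q , p)

SameEdge-trans : {V : Set} {ε : V × V} {x y u v : V} →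
  SameEdge ε x y → SameEdge (x , y) u v → SameEdge ε u v
SameEdge-trans (inj₁ (refl , refl)) h = h
SameEdge-trans (inj₂ (refl , refl)) h = SameEdge-swap h

SameEdge-converse : {V : Set} {ε : V × V} {u v : V} → SameEdge ε u v → SameEdge (u , v) (proj₁ ε) (proj₂ ε)
SameEdge-converse (inj₁ (refl , refl)) = inj₁ (refl , refl)
SameEdge-converse (inj₂ (refl , refl)) = inj₂ (refl , refl)

SameEdge-dec : {V : Set} → DecidableEquality V → (ε : V × V) (u v : V) → Dec (SameEdge ε u v)
SameEdge-dec _≟_ (s , t) u v = ((s ≟ u) ×-dec (t ≟ v)) ⊎-dec ((s ≟ v) ×-dec (t ≟ u))

Covers-sym : {V : Set} {p : Piece V} {u v : V} → Covers p u v → Covers p v u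
Covers-sym = Any.map SameEdge-sym

Covers-dec : {V : Set} → DecidableEquality V → (p : Piece V) (u v : V) → Dec (Covers p u v)
Covers-dec _≟_ p u v = any? (λ ε → SameEdge-dec _≟_ ε u v) (edges p)

mapPiece : {A B : Set} → (A → B) → Piece A → Piece B
mapPiece g (star x y z w) = star (g x) (g y) (g z) (g w)
mapPiece g (tri x y z)    = tri (g x) (g y) (g z)
mapPiece g (path x y z w) = path (g x) (g y) (g z) (g w)

map× : {A B : Set} → (A → B) → A × A → B × B
map× g (s , t) = g s , g t

verts-mapPiece : {A B : Set} (g : A → B) (p : Piece A) → verts (mapPiece g p) ≡ map g (verts p)
verts-mapPiece g (star _ _ _ _) = refl
verts-mapPiece g (tri _ _ _)    = refl
verts-mapPiece g (path _ _ _ _) = refl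

edges-mapPiece : {A B : Set} (g : A → B) (p : Piece A) → edges (mapPiece g p) ≡ map (map× g) (edges p)
edges-mapPiece g (star _ _ _ _) = refl
edges-mapPiece g (tri _ _ _)    = refl
edges-mapPiece g (path _ _ _ _) = refl

NotTri-mapPiece : {A B : Set} (g : A → B) (p : Piece A) → NotTri p → NotTri (mapPiece g p)
NotTri-mapPiece g (star _ _ _ _) _ = tt
NotTri-mapPiece g (path _ _ _ _) _ = tt

EdgesIn : {V : Set} → (V → V → Set) → Piece V → Set
EdgesIn E p = All (λ ε → E (proj₁ ε) (proj₂ ε)) (edges p)

Covers⇒edge : {V : Set} {E : V → V → Set} → (∀ {x y} → E x y → E y x) →
  (p : Piece V) → EdgesIn E p → {x y : V} → Covers p x y → E x y
Covers⇒edge {V} {E} E-sym p es = go es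
  where
  go : {εs : List (V × V)} {x y : V} → All (λ ε → E (proj₁ ε) (proj₂ ε)) εs → Any (λ ε → SameEdge ε x y) εs → E x y
  go (h ∷ _)  (here (inj₁ (refl , refl))) = h
  go (h ∷ _)  (here (inj₂ (refl , refl))) = E-sym h
  go (_ ∷ hs) (there cov)                 = go hs cov

Any-transport : {A B : Set} {R : A → B → Set} {P : A → Set} {Q : B → Set} →
  (∀ {x y} → R x y → P x → Q y) → {xs : List A} {ys : List B} →
  All (λ x → Any (R x) ys) xs → Any P xs → Any Q ys
Any-transport h (r ∷ _)  (here p)  = Any.map (λ rxy → h rxy p) r
Any-transport h (_ ∷ rs) (there p) = Any-transport h rs p

-- Decompositions indexed by finite types

record IndexedDecomposition (V : Set) (E : V → V → Set) (I : Set) : Set where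
  field
    part            : I → Piece V
    partDistinct    : (i : I) → AllPairs _≢_ (verts (part i))
    partInE         : (i : I) → EdgesIn E (part i)
    partExactlyOnce : (u v : V) → E u v →
      Σ I λ i → Covers (part i) u v × ((j : I) → Covers (part j) u v → j ≡ i)

Enumeration : Set → Set
Enumeration I = Σ ℕ λ k → Fin k ↔ I

enumerate : {V : Set} {E : V → V → Set} {I : Set} → Enumeration I →
  IndexedDecomposition V E I → Decomposition V E
enumerate {V} {E} (k , φ) D = record
  { size = k ; piece = part ∘ to ; distinct = partDistinct ∘ to ; inE = partInE ∘ to ; exactlyOnce = once }
  where
  open IndexedDecomposition D
  open Inverse φ
  once : (u v : V) → E u v →
    Σ (Fin k) λ j → Covers (part (to j)) u v × ((j′ : Fin k) → Covers (part (to j′)) u v → j′ ≡ j)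
  once u v uv with partExactlyOnce u v uv
  ... | i , cov , unique =
    from i , subst (λ i′ → Covers (part i′) u v) (sym (strictlyInverseˡ i)) cov ,
    λ j cov′ → trans (sym (strictlyInverseʳ j)) (cong from (unique (to j) cov′))

Enumeration-Fin : (k : ℕ) → Enumeration (Fin k)
Enumeration-Fin k = k , ↔-refl

Enumeration-⊎ : {A B : Set} → Enumeration A → Enumeration B → Enumeration (A ⊎ B)
Enumeration-⊎ (k , φ) (l , ψ) = k + l , ↔-trans +↔⊎ (φ ⊎-↔ ψ)

Enumeration-× : {A B : Set} → Enumeration A → Enumeration B → Enumeration (A × B)
Enumeration-× (k , φ) (l , ψ) = k * l , ↔-trans *↔× (φ ×-↔ ψ)

Enumeration-T : (b : Bool) → Enumeration (T b)
Enumeration-T true  = 1 , 1↔⊤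
Enumeration-T false = 0 , 0↔⊥

Σ-Fin-suc↔ : {s : ℕ} (Q : Fin (suc s) → Set) → (Q Fin.zero ⊎ Σ (Fin s) (Q ∘ Fin.suc)) ↔ Σ (Fin (suc s)) Q
Σ-Fin-suc↔ Q = mk↔ₛ′ to from to∘from from∘to
  where
  to : _ → _
  to (inj₁ q)       = Fin.zero , q
  to (inj₂ (j , q)) = Fin.suc j , q
  from : _ → _
  from (Fin.zero , q)  = inj₁ q
  from (Fin.suc j , q) = inj₂ (j , q)
  to∘from : ∀ y → to (from y) ≡ y
  to∘from (Fin.zero , _)  = refl
  to∘from (Fin.suc _ , _) = refl
  from∘to : ∀ x → from (to x) ≡ x
  from∘to (inj₁ _) = refl
  from∘to (inj₂ _) = refl

Enumeration-filter : (s : ℕ) (P : Fin s → Bool) → Enumeration (Σ (Fin s) (T ∘ P))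
Enumeration-filter zero    P = 0 , mk↔ₛ′ (λ ()) (λ { (() , _) }) (λ { (() , _) }) (λ ())
Enumeration-filter (suc s) P with Enumeration-⊎ (Enumeration-T (P Fin.zero)) (Enumeration-filter s (P ∘ Fin.suc))
... | k , φ = k , ↔-trans φ (Σ-Fin-suc↔ (T ∘ P))

-- One gadget seen from inside

coFishCode : CoFish → ℕ
coFishCode a = 0
coFishCode b = 1
coFishCode c = 2
coFishCode d = 3
coFishCode e = 4
coFishCode f = 5

coFishDecode : ℕ → CoFish
coFishDecode 0 = a
coFishDecode 1 = b
coFishDecode 2 = c
coFishDecode 3 = d
coFishDecode 4 = e
coFishDecode _ = f

coFishDecode-code : (x : CoFish) → coFishDecode (coFishCode x) ≡ x
coFishDecode-code a = refl
coFishDecode-code b = refl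
coFishDecode-code c = refl
coFishDecode-code d = refl
coFishDecode-code e = refl
coFishDecode-code f = refl

_≟ᶜ_ : DecidableEquality CoFish
x ≟ᶜ y = map′ injective (cong coFishCode) (coFishCode x ℕ.≟ coFishCode y)
  where
  injective : coFishCode x ≡ coFishCode y → x ≡ y
  injective eq = trans (sym (coFishDecode-code x)) (trans (cong coFishDecode eq) (coFishDecode-code y))

allCoFish : List CoFish
allCoFish = a ∷ b ∷ c ∷ d ∷ e ∷ f ∷ []

data Local : Set where
  inside  : CoFish → Local
  outside : Local

inside-injective : {x y : CoFish} → inside x ≡ inside y → x ≡ y
inside-injective refl = refl

_≟ˡ_ : DecidableEquality Local
inside x ≟ˡ inside y = map′ (cong inside) inside-injective (x ≟ᶜ y)
inside _ ≟ˡ outside  = no λ ()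
outside  ≟ˡ inside _ = no λ ()
outside  ≟ˡ outside  = yes refl

allLocals : List Local
allLocals = outside ∷ map inside allCoFish

∈-allLocals : (x : Local) → x ∈ allLocals
∈-allLocals outside    = here refl
∈-allLocals (inside a) = there (here refl)
∈-allLocals (inside b) = there (there (here refl))
∈-allLocals (inside c) = there (there (there (here refl)))
∈-allLocals (inside d) = there (there (there (there (here refl))))
∈-allLocals (inside e) = there (there (there (there (there (here refl)))))
∈-allLocals (inside f) = there (there (there (there (there (there (here refl))))))

coEᵇ : CoFish → CoFish → Bool
coEᵇ a b = true
coEᵇ a f = true
coEᵇ a d = true
coEᵇ b c = true
coEᵇ b e = true
coEᵇ c d = true
coEᵇ c e = true
coEᵇ d e = true
coEᵇ _ _ = false

coEᵇ-complete : {x y : CoFish} → CoE x y → T (coEᵇ x y)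
coEᵇ-complete ab = tt
coEᵇ-complete af = tt
coEᵇ-complete ad = tt
coEᵇ-complete bc = tt
coEᵇ-complete be = tt
coEᵇ-complete cd = tt
coEᵇ-complete ce = tt
coEᵇ-complete de = tt

-- outside stands for every vertex of G′ not in the gadget, so outside–outside edges are allowed
-- and the only edges leaving the gadget are those at f.
LocalAdj : Local → Local → Set
LocalAdj (inside x) (inside y) = T (coEᵇ x y ∨ coEᵇ y x)
LocalAdj (inside x) outside    = x ≡ f
LocalAdj outside    (inside y) = y ≡ f
LocalAdj outside    outside    = ⊤

LocalAdj-dec : (x y : Local) → Dec (LocalAdj x y)
LocalAdj-dec (inside x) (inside y) = T? (coEᵇ x y ∨ coEᵇ y x)
LocalAdj-dec (inside x) outside    = x ≟ᶜ f
LocalAdj-dec outside    (inside y) = y ≟ᶜ f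
LocalAdj-dec outside    outside    = yes tt

CoAdj⇒LocalAdj : {x y : CoFish} → CoAdj x y → LocalAdj (inside x) (inside y)
CoAdj⇒LocalAdj (inj₁ xy) = Equivalence.from T-∨ (inj₁ (coEᵇ-complete xy))
CoAdj⇒LocalAdj {x} {y} (inj₂ yx) = Equivalence.from (T-∨ {coEᵇ x y}) (inj₂ (coEᵇ-complete yx))

-- distinct vertices of G′ may both look like outside
Separated : Local → Local → Set
Separated x y = x ≡ outside ⊎ y ≡ outside ⊎ x ≢ y

Separated-dec : (x y : Local) → Dec (Separated x y)
Separated-dec x y = (x ≟ˡ outside) ⊎-dec (y ≟ˡ outside) ⊎-dec ¬? (x ≟ˡ y)

NotTri-dec : {V : Set} (p : Piece V) → Dec (NotTri p)
NotTri-dec (star _ _ _ _) = yes tt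
NotTri-dec (tri _ _ _)    = no λ ()
NotTri-dec (path _ _ _ _) = yes tt

ValidLocal : Piece Local → Set
ValidLocal p = NotTri p × AllPairs Separated (verts p) × All (λ ε → LocalAdj (proj₁ ε) (proj₂ ε)) (edges p)

ValidLocal-dec : (p : Piece Local) → Dec (ValidLocal p)
ValidLocal-dec p =
  NotTri-dec p ×-dec allPairs? Separated-dec (verts p) ×-dec all? (λ ε → LocalAdj-dec (proj₁ ε) (proj₂ ε)) (edges p)

implies : {x y : Bool} → T (not x ∨ y) → T x → T y
implies {true} t _ = t

forAllLocals : (Local → Bool) → Bool
forAllLocals Q = all Q allLocals

forAllLocals-sound : (Q : Local → Bool) → T (forAllLocals Q) → (x : Local) → T (Q x)
forAllLocals-sound Q t x = All.lookup (all⁺ Q allLocals t) (∈-allLocals x)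

module _ (Q : Piece Local → Bool) where

  private
    holds : Piece Local → Bool
    holds p = not ⌊ ValidLocal-dec p ⌋ ∨ Q p

    at₄ : Local → Local → Local → Local → Bool
    at₄ x y z w = holds (star x y z w) ∧ holds (path x y z w)

    at₃ : Local → Local → Local → Bool
    at₃ x y z = forAllLocals (at₄ x y z)

    at₂ : Local → Local → Bool
    at₂ x y = forAllLocals (at₃ x y)

    at₁ : Local → Bool
    at₁ x = forAllLocals (at₂ x)

  forAllValid : Bool
  forAllValid = forAllLocals at₁

  forAllValid-sound : T forAllValid → (p : Piece Local) → ValidLocal p → T (Q p)
  forAllValid-sound t p v@(notTri , _) = implies {⌊ ValidLocal-dec p ⌋} (nonTri p notTri) (fromWitness v)
    where
    both : (x y z w : Local) → T (at₄ x y z w)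
    both x y z w =
      forAllLocals-sound (at₄ x y z)
        (forAllLocals-sound (at₃ x y) (forAllLocals-sound (at₂ x) (forAllLocals-sound at₁ t x) y) z) w
    nonTri : (p : Piece Local) → NotTri p → T (holds p)
    nonTri (star x y z w) _ = proj₁ (Equivalence.to T-∧ (both x y z w))
    nonTri (path x y z w) _ = proj₂ (Equivalence.to (T-∧ {holds (star x y z w)}) (both x y z w))

data FishEdge : Set where
  ⟨_⟩ : {x y : CoFish} → CoE x y → FishEdge

endpoints : FishEdge → CoFish × CoFish
endpoints (⟨_⟩ {x} {y} _) = x , y

CoversFish : Piece Local → FishEdge → Set
CoversFish p ε = Covers p (inside (proj₁ (endpoints ε))) (inside (proj₂ (endpoints ε)))

allFishEdges : List FishEdge
allFishEdges = ⟨ af ⟩ ∷ ⟨ ab ⟩ ∷ ⟨ ad ⟩ ∷ ⟨ bc ⟩ ∷ ⟨ be ⟩ ∷ ⟨ cd ⟩ ∷ ⟨ ce ⟩ ∷ ⟨ de ⟩ ∷ []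

∈-allFishEdges : (ε : FishEdge) → ε ∈ allFishEdges
∈-allFishEdges ⟨ af ⟩ = here refl
∈-allFishEdges ⟨ ab ⟩ = there (here refl)
∈-allFishEdges ⟨ ad ⟩ = there (there (here refl))
∈-allFishEdges ⟨ bc ⟩ = there (there (there (here refl)))
∈-allFishEdges ⟨ be ⟩ = there (there (there (there (here refl))))
∈-allFishEdges ⟨ cd ⟩ = there (there (there (there (there (here refl)))))
∈-allFishEdges ⟨ ce ⟩ = there (there (there (there (there (there (here refl))))))
∈-allFishEdges ⟨ de ⟩ = there (there (there (there (there (there (there (here refl)))))))

_≟ᶠ_ : DecidableEquality FishEdge
ε ≟ᶠ ε′ = map′ injective (cong code) (×-≡-dec ℕ._≟_ ℕ._≟_ (code ε) (code ε′))
  where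
  code : FishEdge → ℕ × ℕ
  code ε = coFishCode (proj₁ (endpoints ε)) , coFishCode (proj₂ (endpoints ε))
  decode : ℕ × ℕ → FishEdge
  decode (0 , 5) = ⟨ af ⟩
  decode (0 , 1) = ⟨ ab ⟩
  decode (0 , 3) = ⟨ ad ⟩
  decode (1 , 2) = ⟨ bc ⟩
  decode (1 , 4) = ⟨ be ⟩
  decode (2 , 3) = ⟨ cd ⟩
  decode (2 , 4) = ⟨ ce ⟩
  decode _       = ⟨ de ⟩
  decode-code : ∀ ε → decode (code ε) ≡ ε
  decode-code ⟨ af ⟩ = refl
  decode-code ⟨ ab ⟩ = refl
  decode-code ⟨ ad ⟩ = refl
  decode-code ⟨ bc ⟩ = refl
  decode-code ⟨ be ⟩ = refl
  decode-code ⟨ cd ⟩ = refl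
  decode-code ⟨ ce ⟩ = refl
  decode-code ⟨ de ⟩ = refl
  injective : code ε ≡ code ε′ → ε ≡ ε′
  injective eq = trans (sym (decode-code ε)) (trans (cong decode eq) (decode-code ε′))

Pattern : Set
Pattern = List FishEdge

_≟ᵖ_ : DecidableEquality Pattern
_≟ᵖ_ = Listₚ.≡-dec _≟ᶠ_

open DecMembership _≟ᶠ_ using () renaming (_∈?_ to _∈ᶠ?_)
open DecMembership _≟ᵖ_ using () renaming (_∈?_ to _∈ᵖ?_)

CoversFish-dec : (p : Piece Local) (ε : FishEdge) → Dec (CoversFish p ε)
CoversFish-dec p ε = Covers-dec _≟ˡ_ p _ _

-- in the order of allFishEdges, on which afPatternᵇ relies
coverPattern : Piece Local → Pattern
coverPattern p = filter (CoversFish-dec p) allFishEdges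

coverPattern⁺ : {p : Piece Local} {ε : FishEdge} → CoversFish p ε → ε ∈ coverPattern p
coverPattern⁺ {p} {ε} = ∈-filter⁺ (CoversFish-dec p) (∈-allFishEdges ε)

coverPattern⁻ : {p : Piece Local} {ε : FishEdge} → ε ∈ coverPattern p → CoversFish p ε
coverPattern⁻ {p} = proj₂ ∘ ∈-filter⁻ (CoversFish-dec p)

-- Contains the cover pattern of every valid local piece, as valid⇒allowed checks exhaustively.
allowedPatterns : List Pattern
allowedPatterns =
  [] ∷
  (⟨ be ⟩ ∷ ⟨ ce ⟩ ∷ ⟨ de ⟩ ∷ []) ∷
  (⟨ be ⟩ ∷ ⟨ cd ⟩ ∷ ⟨ de ⟩ ∷ []) ∷
  (⟨ be ⟩ ∷ ⟨ cd ⟩ ∷ ⟨ ce ⟩ ∷ []) ∷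
  (⟨ bc ⟩ ∷ ⟨ ce ⟩ ∷ ⟨ de ⟩ ∷ []) ∷
  (⟨ bc ⟩ ∷ ⟨ cd ⟩ ∷ ⟨ de ⟩ ∷ []) ∷
  (⟨ bc ⟩ ∷ ⟨ cd ⟩ ∷ ⟨ ce ⟩ ∷ []) ∷
  (⟨ bc ⟩ ∷ ⟨ be ⟩ ∷ ⟨ de ⟩ ∷ []) ∷
  (⟨ bc ⟩ ∷ ⟨ be ⟩ ∷ ⟨ cd ⟩ ∷ []) ∷
  (⟨ ad ⟩ ∷ ⟨ ce ⟩ ∷ ⟨ de ⟩ ∷ []) ∷
  (⟨ ad ⟩ ∷ ⟨ cd ⟩ ∷ ⟨ de ⟩ ∷ []) ∷
  (⟨ ad ⟩ ∷ ⟨ cd ⟩ ∷ ⟨ ce ⟩ ∷ []) ∷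
  (⟨ ad ⟩ ∷ ⟨ be ⟩ ∷ ⟨ de ⟩ ∷ []) ∷
  (⟨ ad ⟩ ∷ ⟨ bc ⟩ ∷ ⟨ cd ⟩ ∷ []) ∷
  (⟨ ab ⟩ ∷ ⟨ be ⟩ ∷ ⟨ de ⟩ ∷ []) ∷
  (⟨ ab ⟩ ∷ ⟨ be ⟩ ∷ ⟨ ce ⟩ ∷ []) ∷
  (⟨ ab ⟩ ∷ ⟨ bc ⟩ ∷ ⟨ ce ⟩ ∷ []) ∷
  (⟨ ab ⟩ ∷ ⟨ bc ⟩ ∷ ⟨ cd ⟩ ∷ []) ∷
  (⟨ ab ⟩ ∷ ⟨ bc ⟩ ∷ ⟨ be ⟩ ∷ []) ∷
  (⟨ ab ⟩ ∷ ⟨ ad ⟩ ∷ ⟨ de ⟩ ∷ []) ∷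
  (⟨ ab ⟩ ∷ ⟨ ad ⟩ ∷ ⟨ cd ⟩ ∷ []) ∷
  (⟨ ab ⟩ ∷ ⟨ ad ⟩ ∷ ⟨ be ⟩ ∷ []) ∷
  (⟨ ab ⟩ ∷ ⟨ ad ⟩ ∷ ⟨ bc ⟩ ∷ []) ∷
  (⟨ af ⟩ ∷ []) ∷
  (⟨ af ⟩ ∷ ⟨ ad ⟩ ∷ []) ∷
  (⟨ af ⟩ ∷ ⟨ ad ⟩ ∷ ⟨ de ⟩ ∷ []) ∷
  (⟨ af ⟩ ∷ ⟨ ad ⟩ ∷ ⟨ cd ⟩ ∷ []) ∷
  (⟨ af ⟩ ∷ ⟨ ab ⟩ ∷ []) ∷
  (⟨ af ⟩ ∷ ⟨ ab ⟩ ∷ ⟨ be ⟩ ∷ []) ∷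
  (⟨ af ⟩ ∷ ⟨ ab ⟩ ∷ ⟨ bc ⟩ ∷ []) ∷
  (⟨ af ⟩ ∷ ⟨ ab ⟩ ∷ ⟨ ad ⟩ ∷ []) ∷
  []

valid⇒allowed : (p : Piece Local) → ValidLocal p → coverPattern p ∈ allowedPatterns
valid⇒allowed p v = toWitness (forAllValid-sound Q tt p v)
  where
  Q : Piece Local → Bool
  Q p = ⌊ coverPattern p ∈ᵖ? allowedPatterns ⌋

IsInside : Local → Set
IsInside x = Σ CoFish λ y → x ≡ inside y

IsInside-dec : (x : Local) → Dec (IsInside x)
IsInside-dec (inside y) = yes (y , refl)
IsInside-dec outside    = no λ { (_ , ()) }

AFPath : Piece Local → Set
AFPath p = Σ CoFish λ y →
  p ≡ path outside (inside f) (inside a) (inside y) ⊎ p ≡ path (inside y) (inside a) (inside f) outside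

Leaving : Local → Local → Local → Local → Set
Leaving x y z w = x ≡ outside × y ≡ inside f × z ≡ inside a × IsInside w

Leaving-dec : (x y z w : Local) → Dec (Leaving x y z w)
Leaving-dec x y z w = (x ≟ˡ outside) ×-dec (y ≟ˡ inside f) ×-dec (z ≟ˡ inside a) ×-dec IsInside-dec w

afPathᵇ : Piece Local → Bool
afPathᵇ (path x y z w) = ⌊ Leaving-dec x y z w ⌋ ∨ ⌊ Leaving-dec w z y x ⌋
afPathᵇ _              = false

afPathᵇ-sound : (p : Piece Local) → T (afPathᵇ p) → AFPath p
afPathᵇ-sound (path x y z w) t with Equivalence.to (T-∨ {⌊ Leaving-dec x y z w ⌋}) t
... | inj₁ forward with toWitness forward
...   | refl , refl , refl , (v , refl) = v , inj₁ refl
afPathᵇ-sound (path x y z w) t | inj₂ backward with toWitness backward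
...   | refl , refl , refl , (v , refl) = v , inj₂ refl

afPatternᵇ : Maybe Pattern → Bool
afPatternᵇ (just q) = ⌊ q ≟ᵖ (⟨ af ⟩ ∷ ⟨ ab ⟩ ∷ []) ⌋ ∨ ⌊ q ≟ᵖ (⟨ af ⟩ ∷ ⟨ ad ⟩ ∷ []) ⌋
afPatternᵇ nothing  = false

afPattern⇒AFPath : (p : Piece Local) → ValidLocal p → T (afPatternᵇ (just (coverPattern p))) → AFPath p
afPattern⇒AFPath p v = afPathᵇ-sound p ∘ implies (forAllValid-sound Q tt p v)
  where
  Q : Piece Local → Bool
  Q p = not (afPatternᵇ (just (coverPattern p))) ∨ afPathᵇ p

HasInsideEdge : Piece Local → Set
HasInsideEdge p = Any (λ ε → IsInside (proj₁ ε) × IsInside (proj₂ ε)) (edges p)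

TouchesOutside : Piece Local → Set
TouchesOutside p = Any (λ ε → proj₁ ε ≡ outside ⊎ proj₂ ε ≡ outside) (edges p)

HasInsideEdge-dec : (p : Piece Local) → Dec (HasInsideEdge p)
HasInsideEdge-dec p = any? (λ ε → IsInside-dec (proj₁ ε) ×-dec IsInside-dec (proj₂ ε)) (edges p)

TouchesOutside-dec : (p : Piece Local) → Dec (TouchesOutside p)
TouchesOutside-dec p = any? (λ ε → (proj₁ ε ≟ˡ outside) ⊎-dec (proj₂ ε ≟ˡ outside)) (edges p)

-- Pieces are connected, f is the only gadget vertex with outside neighbours and a its only inside
-- neighbour, so a piece meeting both sides contains af.
valid-mixed⇒covers-af : (p : Piece Local) → ValidLocal p → HasInsideEdge p → TouchesOutside p →
  Covers p (inside a) (inside f)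
valid-mixed⇒covers-af p v hi to =
  toWitness (implies {⌊ mixed p ⌋} (forAllValid-sound Q tt p v) (fromWitness (hi , to)))
  where
  mixed : (p : Piece Local) → Dec (HasInsideEdge p × TouchesOutside p)
  mixed p = HasInsideEdge-dec p ×-dec TouchesOutside-dec p
  Q : Piece Local → Bool
  Q p = not ⌊ mixed p ⌋ ∨ ⌊ Covers-dec _≟ˡ_ p (inside a) (inside f) ⌋

Assignment : Set
Assignment = FishEdge → Maybe Pattern

assign : Assignment → Pattern → Assignment
assign σ q ε = if ⌊ ε ∈ᶠ? q ⌋ then just q else σ ε

agreesᵇ : Maybe Pattern → Pattern → Bool
agreesᵇ nothing  _ = true
agreesᵇ (just q) r = ⌊ q ≟ᵖ r ⌋

compatibleᵇ : Assignment → Pattern → Bool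
compatibleᵇ σ q = all (λ ε → agreesᵇ (σ ε) q) q

firstUnassigned : Assignment → Maybe FishEdge
firstUnassigned σ = head (filterᵇ (is-nothing ∘ σ) allFishEdges)

-- Backtracking search: give the next unassigned fish edge each allowed pattern containing it that
-- is consistent with σ, and check that every complete assignment gives af the pattern of a path
-- leaving through f and a.
afForcedᵇ : ℕ → Assignment → Bool
afForcedAtᵇ : ℕ → Assignment → Maybe FishEdge → Bool
tryPatternᵇ : ℕ → Assignment → FishEdge → Pattern → Bool
afForcedᵇ zero    σ = false
afForcedᵇ (suc k) σ = afForcedAtᵇ k σ (firstUnassigned σ)
afForcedAtᵇ k σ nothing  = afPatternᵇ (σ ⟨ af ⟩)
afForcedAtᵇ k σ (just ε) = all (tryPatternᵇ k σ ε) allowedPatterns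
tryPatternᵇ k σ ε q = not (⌊ ε ∈ᶠ? q ⌋ ∧ compatibleᵇ σ q) ∨ afForcedᵇ k (assign σ q)

module _ (π : FishEdge → Pattern) (π-own : ∀ ε → ε ∈ π ε)
  (π-coherent : ∀ ε ε′ → ε′ ∈ π ε → π ε′ ≡ π ε) (π-allowed : ∀ ε → π ε ∈ allowedPatterns) where

  private
    Agrees : Assignment → Set
    Agrees σ = (ε : FishEdge) (q : Pattern) → σ ε ≡ just q → π ε ≡ q

    compatible : (σ : Assignment) → Agrees σ → (ε : FishEdge) → T (compatibleᵇ σ (π ε))
    compatible σ ag ε = all⁻ (λ ε′ → agreesᵇ (σ ε′) (π ε)) (All.tabulate agree)
      where
      agree : {ε′ : FishEdge} → ε′ ∈ π ε → T (agreesᵇ (σ ε′) (π ε))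
      agree {ε′} ε′∈ with σ ε′ in eq
      ... | nothing = tt
      ... | just q  = fromWitness (trans (sym (ag ε′ q eq)) (π-coherent ε ε′ ε′∈))

    assign-agrees : (σ : Assignment) → Agrees σ → (ε : FishEdge) → Agrees (assign σ (π ε))
    assign-agrees σ ag ε ε′ q eq with ε′ ∈ᶠ? π ε
    ... | yes ε′∈ = trans (π-coherent ε ε′ ε′∈) (just-injective eq)
    ... | no _    = ag ε′ q eq

  afForced-sound : (k : ℕ) (σ : Assignment) → Agrees σ → T (afForcedᵇ k σ) → T (afPatternᵇ (just (π ⟨ af ⟩)))
  afForcedAt-sound : (k : ℕ) (σ : Assignment) (next : Maybe FishEdge) → Agrees σ →
    T (afForcedAtᵇ k σ next) → T (afPatternᵇ (just (π ⟨ af ⟩)))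
  afForced-sound (suc k) σ ag t = afForcedAt-sound k σ (firstUnassigned σ) ag t
  afForcedAt-sound k σ nothing ag t with σ ⟨ af ⟩ in eq
  ... | just q rewrite ag ⟨ af ⟩ q eq = t
  afForcedAt-sound k σ (just ε) ag t =
    afForced-sound k (assign σ (π ε)) (assign-agrees σ ag ε)
      (implies {⌊ ε ∈ᶠ? π ε ⌋ ∧ compatibleᵇ σ (π ε)}
        (All.lookup (all⁺ (tryPatternᵇ k σ ε) allowedPatterns t) (π-allowed ε))
        (Equivalence.from T-∧ (fromWitness (π-own ε) , compatible σ ag ε)))

  afForced : T (afPatternᵇ (just (π ⟨ af ⟩)))
  afForced = afForced-sound 9 (λ _ → nothing) (λ _ _ ()) tt  -- each step assigns one of 8 fish edges

af-forced : (lp : FishEdge → Piece Local) → (∀ ε → ValidLocal (lp ε)) → (∀ ε → CoversFish (lp ε) ε) →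
  (∀ ε ε′ → CoversFish (lp ε) ε′ → lp ε′ ≡ lp ε) → AFPath (lp ⟨ af ⟩)
af-forced lp valid own coherent =
  afPattern⇒AFPath (lp ⟨ af ⟩) (valid ⟨ af ⟩)
    (afForced (coverPattern ∘ lp) (λ ε → coverPattern⁺ (own ε))
      (λ ε ε′ ε′∈ → cong coverPattern (coherent ε ε′ (coverPattern⁻ ε′∈)))
      (λ ε → valid⇒allowed (lp ε) (valid ε)))

module Attachment (n : ℕ) (adj : Fin n → Fin n → Bool)
  (adj-sym : (u v : Fin n) → adj u v ≡ adj v u) (adj-irrefl : (v : Fin n) → adj v v ≡ false)
  (m : ℕ) (M : Fin m → Fin n × Fin n) (M-edge : (i : Fin m) → T (adj (proj₁ (M i)) (proj₂ (M i))))
  (M-injective : (i j : Fin m) → SameEdge (M i) (proj₁ (M j)) (proj₂ (M j)) → i ≡ j) where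

  V′ : Set
  V′ = AttV n m

  E′ : V′ → V′ → Set
  E′ = AttE adj M

  E : Fin n → Fin n → Set
  E = EG adj

  InM : Fin n → Fin n → Set
  InM = MEdge M

  end₁ end₂ : Fin m → Fin n
  end₁ i = proj₁ (M i)
  end₂ i = proj₂ (M i)

  IsEnd : Fin m → Fin n → Set
  IsEnd i t = t ≡ end₁ i ⊎ t ≡ end₂ i

  sub : Fin m → V′
  sub i = inj₂ (i , f)

  gadget : Fin m → CoFish → V′
  gadget i x = inj₂ (i , x)

  _≟′_ : DecidableEquality V′
  inj₁ x ≟′ inj₁ y with x Fin.≟ y
  ... | yes refl = yes refl
  ... | no x≢y   = no λ { refl → x≢y refl }
  inj₁ _ ≟′ inj₂ _ = no λ ()
  inj₂ _ ≟′ inj₁ _ = no λ ()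
  inj₂ (i , x) ≟′ inj₂ (j , y) with i Fin.≟ j | x ≟ᶜ y
  ... | yes refl | yes refl = yes refl
  ... | no i≢j   | _        = no λ { refl → i≢j refl }
  ... | yes _    | no x≢y   = no λ { refl → x≢y refl }

  InM-dec : (u v : Fin n) → Dec (InM u v)
  InM-dec u v = Finₚ.any? (λ i → SameEdge-dec Fin._≟_ (M i) u v)

  InM-sym : {u v : Fin n} → InM u v → InM v u
  InM-sym (i , se) = i , SameEdge-sym se

  adj-symmetric : {u v : Fin n} → T (adj u v) → T (adj v u)
  adj-symmetric {u} {v} = subst T (adj-sym u v)

  adj-irreflexive : {u v : Fin n} → T (adj u v) → u ≢ v
  adj-irreflexive {u} uv refl = subst T (adj-irrefl u) uv

  end₁≢end₂ : (i : Fin m) → end₁ i ≢ end₂ i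
  end₁≢end₂ i = adj-irreflexive (M-edge i)

  E′-sym : {x y : V′} → E′ x y → E′ y x
  E′-sym (old uv notM)      = old (adj-symmetric uv) (λ i se → notM i (SameEdge-sym se))
  E′-sym (subˡ i)           = subˡ' i
  E′-sym (subˡ' i)          = subˡ i
  E′-sym (subʳ i)           = subʳ' i
  E′-sym (subʳ' i)          = subʳ i
  E′-sym (fish i (inj₁ xy)) = fish i (inj₂ xy)
  E′-sym (fish i (inj₂ yx)) = fish i (inj₁ yx)

  E′-old⁻¹ : {s t : Fin n} → E′ (inj₁ s) (inj₁ t) → T (adj s t) × ((i : Fin m) → ¬ SameEdge (M i) s t)
  E′-old⁻¹ (old st notM) = st , notM

  E′-gadget⁻¹ : {i j : Fin m} {x y : CoFish} → E′ (gadget i x) (gadget j y) → i ≡ j × CoAdj x y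
  E′-gadget⁻¹ (fish i xy) = refl , xy

  E′-leave⁻¹ : {i : Fin m} {x : CoFish} {t : Fin n} → E′ (gadget i x) (inj₁ t) → x ≡ f × IsEnd i t
  E′-leave⁻¹ (subˡ' i) = refl , inj₁ refl
  E′-leave⁻¹ (subʳ i)  = refl , inj₂ refl

  E′-enter⁻¹ : {i : Fin m} {x : CoFish} {t : Fin n} → E′ (inj₁ t) (gadget i x) → x ≡ f × IsEnd i t
  E′-enter⁻¹ = E′-leave⁻¹ ∘′ E′-sym

  sub-neighbours : {i : Fin m} {z : V′} → E′ (sub i) z → z ≡ inj₁ (end₁ i) ⊎ z ≡ inj₁ (end₂ i) ⊎ z ≡ gadget i a
  sub-neighbours (subˡ' i)         = inj₁ refl
  sub-neighbours (subʳ i)          = inj₂ (inj₁ refl)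
  sub-neighbours (fish i (inj₂ af)) = inj₂ (inj₂ refl)
  sub-neighbours (fish i (inj₁ ()))

  E′-end : (i : Fin m) {t : Fin n} → IsEnd i t → E′ (inj₁ t) (sub i)
  E′-end i (inj₁ refl) = subˡ i
  E′-end i (inj₂ refl) = subʳ' i

  otherEnd : Fin m → Fin n → Fin n
  otherEnd i x with x Fin.≟ end₁ i
  ... | yes _ = end₂ i
  ... | no _  = end₁ i

  otherEnd-SameEdge : (i : Fin m) {x : Fin n} → IsEnd i x → SameEdge (M i) x (otherEnd i x)
  otherEnd-SameEdge i {x} end with x Fin.≟ end₁ i
  ... | yes refl = inj₁ (refl , refl)
  ... | no x≢end₁ with end
  ...   | inj₁ eq   = ⊥-elim (x≢end₁ eq)
  ...   | inj₂ refl = inj₂ (refl , refl)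

  M-distinct : {i : Fin m} {x y : Fin n} → SameEdge (M i) x y → x ≢ y
  M-distinct {i} (inj₁ (refl , refl)) = end₁≢end₂ i
  M-distinct {i} (inj₂ (refl , refl)) = end₁≢end₂ i ∘ sym

  M-adj : {i : Fin m} {x y : Fin n} → SameEdge (M i) x y → T (adj x y)
  M-adj {i} (inj₁ (refl , refl)) = M-edge i
  M-adj {i} (inj₂ (refl , refl)) = adj-symmetric (M-edge i)

  M-IsEnd : {i : Fin m} {x y : Fin n} → SameEdge (M i) x y → IsEnd i x × IsEnd i y
  M-IsEnd (inj₁ (refl , refl)) = inj₁ refl , inj₂ refl
  M-IsEnd (inj₂ (refl , refl)) = inj₂ refl , inj₁ refl

  M-orientations : {i : Fin m} {x y u v : Fin n} → SameEdge (M i) x y → SameEdge (M i) u v →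
    (x ≡ u × y ≡ v) ⊎ (x ≡ v × y ≡ u)
  M-orientations (inj₁ (refl , refl)) (inj₁ (refl , refl)) = inj₁ (refl , refl)
  M-orientations (inj₁ (refl , refl)) (inj₂ (refl , refl)) = inj₂ (refl , refl)
  M-orientations (inj₂ (refl , refl)) (inj₁ (refl , refl)) = inj₂ (refl , refl)
  M-orientations (inj₂ (refl , refl)) (inj₂ (refl , refl)) = inj₁ (refl , refl)

  M-unique : {i j : Fin m} {u v : Fin n} → SameEdge (M i) u v → SameEdge (M j) u v → i ≡ j
  M-unique {i} {j} se (inj₁ (refl , refl)) = M-injective i j se
  M-unique {i} {j} se (inj₂ (refl , refl)) = M-injective i j (SameEdge-sym se)

  IsEnd-other : (i : Fin m) {x t : Fin n} → IsEnd i x → IsEnd i t → x ≢ t → x ≡ otherEnd i t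
  IsEnd-other i x-end t-end x≢t with M-orientations (otherEnd-SameEdge i t-end) (otherEnd-SameEdge i x-end)
  ... | inj₁ (t≡x , _) = ⊥-elim (x≢t (sym t≡x))
  ... | inj₂ (_ , other≡x) = sym other≡x

  IsEnd-cases : {i : Fin m} {x u w : Fin n} → IsEnd i x → SameEdge (M i) u w → x ≡ u ⊎ x ≡ w
  IsEnd-cases (inj₁ refl) (inj₁ (refl , refl)) = inj₁ refl
  IsEnd-cases (inj₁ refl) (inj₂ (refl , refl)) = inj₂ refl
  IsEnd-cases (inj₂ refl) (inj₁ (refl , refl)) = inj₂ refl
  IsEnd-cases (inj₂ refl) (inj₂ (refl , refl)) = inj₁ refl

  view : Fin m → V′ → Local
  view i (inj₁ _) = outside
  view i (inj₂ (j , x)) with j Fin.≟ i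
  ... | yes _ = inside x
  ... | no _  = outside

  view-gadget : (i : Fin m) (x : CoFish) → view i (gadget i x) ≡ inside x
  view-gadget i x with i Fin.≟ i
  ... | yes _  = refl
  ... | no i≢i = ⊥-elim (i≢i refl)

  view⁻¹ : (i : Fin m) (s : V′) {x : CoFish} → view i s ≡ inside x → s ≡ gadget i x
  view⁻¹ i (inj₂ (j , y)) eq with j Fin.≟ i
  view⁻¹ i (inj₂ (j , y)) refl | yes refl = refl

  view-edge : (i : Fin m) {s t : V′} → E′ s t → LocalAdj (view i s) (view i t)
  view-edge i (old _ _) = tt
  view-edge i (subˡ j) with j Fin.≟ i
  ... | yes _ = refl
  ... | no _  = tt
  view-edge i (subˡ' j) with j Fin.≟ i
  ... | yes _ = refl
  ... | no _  = tt
  view-edge i (subʳ j) with j Fin.≟ i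
  ... | yes _ = refl
  ... | no _  = tt
  view-edge i (subʳ' j) with j Fin.≟ i
  ... | yes _ = refl
  ... | no _  = tt
  view-edge i (fish j xy) with j Fin.≟ i
  ... | yes _ = CoAdj⇒LocalAdj xy
  ... | no _  = tt

  view-separated : (i : Fin m) (s t : V′) → s ≢ t → Separated (view i s) (view i t)
  view-separated i s t s≢t with view i s in eqs | view i t in eqt
  ... | outside  | _        = inj₁ refl
  ... | inside _ | outside  = inj₂ (inj₁ refl)
  ... | inside x | inside y = inj₂ (inj₂ λ { refl → s≢t (trans (view⁻¹ i s eqs) (sym (view⁻¹ i t eqt))) })

  view-valid : (i : Fin m) (p : Piece V′) → NotTri p → AllPairs _≢_ (verts p) → EdgesIn E′ p →
    ValidLocal (mapPiece (view i) p)
  view-valid i p notTri dist es =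
    NotTri-mapPiece (view i) p notTri ,
    subst (AllPairs Separated) (sym (verts-mapPiece (view i) p))
      (AllPairsₚ.map⁺ (AllPairs.map (view-separated i _ _) dist)) ,
    subst (All (λ ε → LocalAdj (proj₁ ε) (proj₂ ε))) (sym (edges-mapPiece (view i) p))
      (Allₚ.map⁺ (All.map (view-edge i) es))

  view-covers⁺ : (i : Fin m) (p : Piece V′) {x y : CoFish} →
    Covers p (gadget i x) (gadget i y) → Covers (mapPiece (view i) p) (inside x) (inside y)
  view-covers⁺ i p {x} {y} cov =
    subst (Any (λ ε → SameEdge ε (inside x) (inside y))) (sym (edges-mapPiece (view i) p))
      (Anyₚ.map⁺ (Any.map seen cov))
    where
    seen : {ε : V′ × V′} → SameEdge ε (gadget i x) (gadget i y) → SameEdge (map× (view i) ε) (inside x) (inside y)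
    seen (inj₁ (refl , refl)) = inj₁ (view-gadget i x , view-gadget i y)
    seen (inj₂ (refl , refl)) = inj₂ (view-gadget i y , view-gadget i x)

  view-covers⁻ : (i : Fin m) (p : Piece V′) {x y : CoFish} →
    Covers (mapPiece (view i) p) (inside x) (inside y) → Covers p (gadget i x) (gadget i y)
  view-covers⁻ i p {x} {y} cov =
    Any.map unseen (Anyₚ.map⁻ (subst (Any (λ ε → SameEdge ε (inside x) (inside y))) (edges-mapPiece (view i) p) cov))
    where
    unseen : {ε : V′ × V′} → SameEdge (map× (view i) ε) (inside x) (inside y) → SameEdge ε (gadget i x) (gadget i y)
    unseen {s , t} (inj₁ (p , q)) = inj₁ (view⁻¹ i s p , view⁻¹ i t q)
    unseen {s , t} (inj₂ (p , q)) = inj₂ (view⁻¹ i s p , view⁻¹ i t q)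

  isOld : V′ → Bool
  isOld (inj₁ _) = true
  isOld (inj₂ _) = false

  -- pieces all of whose edges meet an old vertex; these are the ones that survive contraction
  outerᵇ : Piece V′ → Bool
  outerᵇ p = all (λ ε → isOld (proj₁ ε) ∨ isOld (proj₂ ε)) (edges p)

  not-outer⇒gadget-edge : (p : Piece V′) → EdgesIn E′ p → outerᵇ p ≡ false →
    Σ (Fin m) λ i → Σ CoFish λ x → Σ CoFish λ y → Covers p (gadget i x) (gadget i y)
  not-outer⇒gadget-edge p = go (edges p)
    where
    go : (εs : List (V′ × V′)) → All (λ ε → E′ (proj₁ ε) (proj₂ ε)) εs →
      all (λ ε → isOld (proj₁ ε) ∨ isOld (proj₂ ε)) εs ≡ false →
      Σ (Fin m) λ i → Σ CoFish λ x → Σ CoFish λ y → Any (λ ε → SameEdge ε (gadget i x) (gadget i y)) εs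
    go ((inj₁ _ , _) ∷ εs) (_ ∷ es) eq with go εs es eq
    ... | i , x , y , cov = i , x , y , there cov
    go ((inj₂ _ , inj₁ _) ∷ εs) (_ ∷ es) eq with go εs es eq
    ... | i , x , y , cov = i , x , y , there cov
    go ((inj₂ (i , x) , inj₂ (j , y)) ∷ εs) (st ∷ _) eq with E′-gadget⁻¹ st
    ... | refl , _ = i , x , y , here (inj₁ (refl , refl))

  -- Contracting the gadgets

  collapse : V′ → Fin n → Fin n
  collapse (inj₁ t)       _ = t
  collapse (inj₂ (i , _)) x = otherEnd i x

  data OldNeighbour (x : Fin n) : V′ → Set where
    across : (y : Fin n) → T (adj x y) → ((i : Fin m) → ¬ SameEdge (M i) x y) → OldNeighbour x (inj₁ y)
    via    : (i : Fin m) → IsEnd i x → OldNeighbour x (sub i)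

  oldNeighbour : {x : Fin n} {z : V′} → E′ (inj₁ x) z → OldNeighbour x z
  oldNeighbour {z = inj₁ y} xy = across y (proj₁ (E′-old⁻¹ xy)) (proj₂ (E′-old⁻¹ xy))
  oldNeighbour {z = inj₂ (i , _)} xz with E′-enter⁻¹ xz
  ... | refl , end = via i end

  collapse-adj : {x : Fin n} {z : V′} → OldNeighbour x z → T (adj x (collapse z x))
  collapse-adj (across _ xy _) = xy
  collapse-adj (via i end)     = M-adj (otherEnd-SameEdge i end)

  collapse-≢ : {x : Fin n} {z : V′} → OldNeighbour x z → collapse z x ≢ x
  collapse-≢ (across _ xy _) = adj-irreflexive xy ∘ sym
  collapse-≢ (via i end)     = M-distinct (otherEnd-SameEdge i end) ∘ sym

  collapse-≢-old : {x y : Fin n} {z : V′} → OldNeighbour x z → z ≢ inj₁ y → ((i : Fin m) → ¬ SameEdge (M i) x y) →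
    collapse z x ≢ y
  collapse-≢-old (across _ _ _) z≢y _    refl = z≢y refl
  collapse-≢-old (via i end)    _   notM refl = notM i (otherEnd-SameEdge i end)

  collapse-injective : {x : Fin n} {z z′ : V′} → OldNeighbour x z → OldNeighbour x z′ → z ≢ z′ →
    collapse z x ≢ collapse z′ x
  collapse-injective (across y _ _)   (across y′ _ _)  z≢z′ eq = z≢z′ (cong inj₁ eq)
  collapse-injective (across y _ notM) (via i end)     _    eq = notM i (subst (SameEdge (M i) _) (sym eq) (otherEnd-SameEdge i end))
  collapse-injective (via i end)     (across y _ notM) _    eq = notM i (subst (SameEdge (M i) _) eq (otherEnd-SameEdge i end))
  collapse-injective (via i end)     (via j end′)     z≢z′ eq
    with M-unique (otherEnd-SameEdge i end) (subst (SameEdge (M j) _) (sym eq) (otherEnd-SameEdge j end′))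
  ... | refl = z≢z′ refl

  closeUp : (s x y z : Fin n) → Dec (s ≡ z) → Piece (Fin n)
  closeUp s x y z (yes _) = tri x y s
  closeUp s x y z (no _)  = path s x y z

  firstVertex : Piece V′ → V′
  firstVertex (star x _ _ _) = x
  firstVertex (tri x _ _)    = x
  firstVertex (path x _ _ _) = x

  anchor : V′ → Fin n
  anchor (inj₁ t)       = t
  anchor (inj₂ (i , _)) = end₁ i

  -- Contract every gadget back onto its edge of M. A path whose two ends collapse onto the same
  -- vertex closes up into a triangle. Only outer pieces are contracted (contract-outer); on the
  -- remaining shapes the result is an arbitrary placeholder.
  contractPiece : Piece V′ → Piece (Fin n)
  contractPiece (star (inj₁ x) y z w)        = star x (collapse y x) (collapse z x) (collapse w x)
  contractPiece (path s (inj₁ x) (inj₁ y) z) = closeUp (collapse s x) x y (collapse z y) (collapse s x Fin.≟ collapse z y)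
  contractPiece p                            = star t t t t
    where t = anchor (firstVertex p)

  -- an edge x–z of G′ at the old vertex x, and its image x–(collapse z x) in G
  Collapses : V′ × V′ → Fin n × Fin n → Set
  Collapses ε ε̂ = Σ (Fin n) λ x → Σ V′ λ z → OldNeighbour x z ×
    ((ε ≡ (inj₁ x , z) × ε̂ ≡ (x , collapse z x)) ⊎ (ε ≡ (z , inj₁ x) × ε̂ ≡ (collapse z x , x)))

  collapses : {x : Fin n} {z : V′} → OldNeighbour x z → Collapses (inj₁ x , z) (x , collapse z x)
  collapses {x} {z} nb = x , z , nb , inj₁ (refl , refl)

  collapses′ : {x : Fin n} {z : V′} → OldNeighbour x z → Collapses (z , inj₁ x) (collapse z x , x)
  collapses′ {x} {z} nb = x , z , nb , inj₂ (refl , refl)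

  Preimage : V′ × V′ → Fin n → Fin n → Set
  Preimage ε u v = SameEdge ε (inj₁ u) (inj₁ v) ⊎
    Σ (Fin m) λ i → SameEdge (M i) u v × (SameEdge ε (inj₁ u) (sub i) ⊎ SameEdge ε (inj₁ v) (sub i))

  private
    old-image : {x u v : Fin n} {z : V′} → OldNeighbour x z → SameEdge (inj₁ x , z) (inj₁ u) (inj₁ v) →
      SameEdge (x , collapse z x) u v
    old-image (across _ _ _) (inj₁ (p , q)) = inj₁ (inj₁-injective p , inj₁-injective q)
    old-image (across _ _ _) (inj₂ (p , q)) = inj₂ (inj₁-injective p , inj₁-injective q)
    old-image (via _ _) (inj₁ (_ , ()))
    old-image (via _ _) (inj₂ (_ , ()))

    sub-image : {x t : Fin n} {z : V′} {i : Fin m} → OldNeighbour x z → SameEdge (inj₁ x , z) (inj₁ t) (sub i) →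
      SameEdge (x , collapse z x) t (otherEnd i t)
    sub-image (across _ _ _) (inj₁ (_ , ()))
    sub-image (across _ _ _) (inj₂ (() , _))
    sub-image (via _ _) (inj₁ (refl , refl)) = inj₁ (refl , refl)
    sub-image (via _ _) (inj₂ (() , _))

    preimage : {x u v : Fin n} {z : V′} → OldNeighbour x z → SameEdge (x , collapse z x) u v → Preimage (inj₁ x , z) u v
    preimage (across _ _ _) (inj₁ (refl , refl)) = inj₁ (inj₁ (refl , refl))
    preimage (across _ _ _) (inj₂ (refl , refl)) = inj₁ (inj₂ (refl , refl))
    preimage (via i end) (inj₁ (refl , refl)) = inj₂ (i , otherEnd-SameEdge i end , inj₁ (inj₁ (refl , refl)))
    preimage (via i end) (inj₂ (refl , refl)) = inj₂ (i , SameEdge-sym (otherEnd-SameEdge i end) , inj₂ (inj₁ (refl , refl)))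

    Preimage-swap : {s t : V′} {u v : Fin n} → Preimage (s , t) u v → Preimage (t , s) u v
    Preimage-swap (inj₁ se)                 = inj₁ (SameEdge-swap se)
    Preimage-swap (inj₂ (i , se , inj₁ se′)) = inj₂ (i , se , inj₁ (SameEdge-swap se′))
    Preimage-swap (inj₂ (i , se , inj₂ se′)) = inj₂ (i , se , inj₂ (SameEdge-swap se′))

  Collapses-old : {ε : V′ × V′} {ε̂ : Fin n × Fin n} {u v : Fin n} → Collapses ε ε̂ →
    SameEdge ε (inj₁ u) (inj₁ v) → SameEdge ε̂ u v
  Collapses-old (_ , _ , nb , inj₁ (refl , refl)) se = old-image nb se
  Collapses-old (_ , _ , nb , inj₂ (refl , refl)) se = SameEdge-swap (old-image nb (SameEdge-swap se))

  Collapses-sub : {ε : V′ × V′} {ε̂ : Fin n × Fin n} {t : Fin n} {i : Fin m} → Collapses ε ε̂ →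
    SameEdge ε (inj₁ t) (sub i) → SameEdge ε̂ t (otherEnd i t)
  Collapses-sub (_ , _ , nb , inj₁ (refl , refl)) se = sub-image nb se
  Collapses-sub (_ , _ , nb , inj₂ (refl , refl)) se = SameEdge-swap (sub-image nb (SameEdge-swap se))

  Collapses-preimage : {ε : V′ × V′} {ε̂ : Fin n × Fin n} {u v : Fin n} → Collapses ε ε̂ →
    SameEdge ε̂ u v → Preimage ε u v
  Collapses-preimage (_ , _ , nb , inj₁ (refl , refl)) se = preimage nb se
  Collapses-preimage (_ , _ , nb , inj₂ (refl , refl)) se = Preimage-swap (preimage nb (SameEdge-swap se))

  record Contraction (p : Piece V′) (q : Piece (Fin n)) : Set where
    field
      vertices-distinct : AllPairs _≢_ (verts q)
      edges-in-G        : EdgesIn E q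
      valid             : ValidPiece InM q
      images            : All (λ ε → Any (Collapses ε) (edges q)) (edges p)
      preimages         : All (λ ε̂ → Any (λ ε → Collapses ε ε̂) (edges p)) (edges q)

  NotBothEnds : Piece V′ → Set
  NotBothEnds p = (i : Fin m) → ¬ (Covers p (inj₁ (end₁ i)) (sub i) × Covers p (inj₁ (end₂ i)) (sub i))

  private
    both-ends : {p : Piece V′} {i : Fin m} {x y : Fin n} → IsEnd i x → IsEnd i y → x ≢ y →
      Covers p (inj₁ x) (sub i) → Covers p (inj₁ y) (sub i) → ¬ NotBothEnds p
    both-ends (inj₁ refl) (inj₁ refl) x≢y _  _  _  = x≢y refl
    both-ends (inj₁ refl) (inj₂ refl) _   cx cy nb = nb _ (cx , cy)
    both-ends (inj₂ refl) (inj₁ refl) _   cx cy nb = nb _ (cy , cx)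
    both-ends (inj₂ refl) (inj₂ refl) x≢y _  _  _  = x≢y refl

    inj₁-≢ : {x y : Fin n} → _≢_ {A = V′} (inj₁ x) (inj₁ y) → x ≢ y
    inj₁-≢ ne = ne ∘ cong inj₁

  contract-star : (x : Fin n) (y z w : V′) → AllPairs _≢_ (verts (star (inj₁ x) y z w)) →
    EdgesIn E′ (star (inj₁ x) y z w) → Contraction (star (inj₁ x) y z w) (contractPiece (star (inj₁ x) y z w))
  contract-star x y z w ((_ ∷ _ ∷ _ ∷ []) ∷ (y≢z ∷ y≢w ∷ []) ∷ (z≢w ∷ []) ∷ [] ∷ []) (xy ∷ xz ∷ xw ∷ []) = record
    { vertices-distinct =
        ((collapse-≢ ny ∘ sym) ∷ (collapse-≢ nz ∘ sym) ∷ (collapse-≢ nw ∘ sym) ∷ []) ∷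
        (collapse-injective ny nz y≢z ∷ collapse-injective ny nw y≢w ∷ []) ∷
        (collapse-injective nz nw z≢w ∷ []) ∷ [] ∷ []
    ; edges-in-G = collapse-adj ny ∷ collapse-adj nz ∷ collapse-adj nw ∷ []
    ; valid      = tt
    ; images     = here (collapses ny) ∷ there (here (collapses nz)) ∷ there (there (here (collapses nw))) ∷ []
    ; preimages  = here (collapses ny) ∷ there (here (collapses nz)) ∷ there (there (here (collapses nw))) ∷ []
    }
    where
    ny = oldNeighbour xy
    nz = oldNeighbour xz
    nw = oldNeighbour xw

  contract-path : (s : V′) (x y : Fin n) (z : V′) → AllPairs _≢_ (verts (path s (inj₁ x) (inj₁ y) z)) →
    EdgesIn E′ (path s (inj₁ x) (inj₁ y) z) →
    Contraction (path s (inj₁ x) (inj₁ y) z) (contractPiece (path s (inj₁ x) (inj₁ y) z))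
  contract-path s x y z ((_ ∷ s≢y ∷ s≢z ∷ []) ∷ (x≢y ∷ x≢z ∷ []) ∷ (y≢z ∷ []) ∷ [] ∷ [])
                (sx ∷ xy ∷ yz ∷ []) = closes (collapse s x Fin.≟ collapse z y)
    where
    ns = oldNeighbour (E′-sym sx)
    nz = oldNeighbour yz
    x-y = E′-old⁻¹ xy
    ny = across y (proj₁ x-y) (proj₂ x-y)
    notM : ¬ InM x y
    notM (i , se) = proj₂ x-y i se
    s̄ = collapse s x
    z̄ = collapse z y
    s̄≢y : s̄ ≢ y
    s̄≢y = collapse-≢-old ns s≢y (proj₂ x-y)
    z̄≢x : z̄ ≢ x
    z̄≢x = collapse-≢-old nz (x≢z ∘ sym) (λ i → proj₂ x-y i ∘ SameEdge-sym)
    closes : (dq : Dec (s̄ ≡ z̄)) → Contraction (path s (inj₁ x) (inj₁ y) z) (closeUp s̄ x y z̄ dq)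
    closes (no s̄≢z̄) = record
      { vertices-distinct =
          (collapse-≢ ns ∷ s̄≢y ∷ s̄≢z̄ ∷ []) ∷ (inj₁-≢ x≢y ∷ (z̄≢x ∘ sym) ∷ []) ∷ ((collapse-≢ nz ∘ sym) ∷ []) ∷ [] ∷ []
      ; edges-in-G = adj-symmetric (collapse-adj ns) ∷ proj₁ x-y ∷ collapse-adj nz ∷ []
      ; valid      = notM
      ; images     = here (collapses′ ns) ∷ there (here (collapses ny)) ∷ there (there (here (collapses nz))) ∷ []
      ; preimages  = here (collapses′ ns) ∷ there (here (collapses ny)) ∷ there (there (here (collapses nz))) ∷ []
      }
    -- The path closes up only if one of its end edges was a subdivision edge: the contracted
    -- triangle then contains an edge of M, but not the middle edge.
    closes (yes s̄≡z̄) = record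
      { vertices-distinct = (inj₁-≢ x≢y ∷ (collapse-≢ ns ∘ sym) ∷ []) ∷ ((s̄≢y ∘ sym) ∷ []) ∷ [] ∷ []
      ; edges-in-G = proj₁ x-y ∷ subst (T ∘ adj y) (sym s̄≡z̄) (collapse-adj nz) ∷ adj-symmetric (collapse-adj ns) ∷ []
      ; valid      = some-M , λ { (xy∈M , _) → notM xy∈M }
      ; images     = there (there (here (collapses′ ns))) ∷ here (collapses ny) ∷ there (here z-image) ∷ []
      ; preimages  = there (here (collapses ny)) ∷ there (there (here z-image)) ∷ here (collapses′ ns) ∷ []
      }
      where
      z-image : Collapses (inj₁ y , z) (y , s̄)
      z-image = subst (λ t → Collapses (inj₁ y , z) (y , t)) (sym s̄≡z̄) (collapses nz)
      some-M : InM x y ⊎ InM y s̄ ⊎ InM s̄ x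
      some-M with ns | nz
      ... | via i end      | _           = inj₂ (inj₂ (i , SameEdge-sym (otherEnd-SameEdge i end)))
      ... | across _ _ _   | via i end   = inj₂ (inj₁ (i , subst (SameEdge (M i) y) (sym s̄≡z̄) (otherEnd-SameEdge i end)))
      ... | across _ _ _   | across _ _ _ = ⊥-elim (s≢z (cong inj₁ s̄≡z̄))

  contract-outer : (p : Piece V′) → AllPairs _≢_ (verts p) → EdgesIn E′ p → NotTri p → T (outerᵇ p) →
    NotBothEnds p → Contraction p (contractPiece p)
  contract-outer (star (inj₁ x) y z w) ds es _ _ _ = contract-star x y z w ds es
  contract-outer (star (inj₂ _) (inj₂ _) _ _) _ _ _ () _
  contract-outer (star (inj₂ _) (inj₁ _) (inj₂ _) _) _ _ _ () _
  contract-outer p@(star (inj₂ _) (inj₁ x) (inj₁ y) _) (_ ∷ (x≢y ∷ _) ∷ _) (cx ∷ cy ∷ _) _ _ nb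
    with E′-leave⁻¹ cx | E′-leave⁻¹ cy
  ... | refl , x-end | _ , y-end =
    ⊥-elim (both-ends {p} x-end y-end (inj₁-≢ x≢y) (here (inj₂ (refl , refl))) (there (here (inj₂ (refl , refl)))) nb)
  contract-outer (tri _ _ _) _ _ () _ _
  contract-outer (path (inj₂ _) (inj₂ _) _ _) _ _ _ () _
  contract-outer (path (inj₁ _) (inj₂ _) (inj₂ _) _) _ _ _ () _
  contract-outer p@(path (inj₁ s) (inj₂ _) (inj₁ y) _) ((_ ∷ s≢y ∷ _) ∷ _) (sx ∷ xy ∷ _) _ _ nb
    with E′-enter⁻¹ sx | E′-leave⁻¹ xy
  ... | refl , s-end | _ , y-end =
    ⊥-elim (both-ends {p} s-end y-end (inj₁-≢ s≢y) (here (inj₁ (refl , refl))) (there (here (inj₂ (refl , refl)))) nb)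
  contract-outer (path (inj₁ _) (inj₁ _) (inj₂ _) (inj₂ _)) _ _ _ () _
  contract-outer (path (inj₂ _) (inj₁ _) (inj₂ _) (inj₂ _)) _ _ _ () _
  contract-outer p@(path _ (inj₁ x) (inj₂ _) (inj₁ z)) (_ ∷ (_ ∷ x≢z ∷ []) ∷ _) (_ ∷ xy ∷ yz ∷ []) _ _ nb
    with E′-enter⁻¹ xy | E′-leave⁻¹ yz
  ... | refl , x-end | _ , z-end =
    ⊥-elim (both-ends {p} x-end z-end (inj₁-≢ x≢z) (there (here (inj₁ (refl , refl))))
      (there (there (here (inj₂ (refl , refl))))) nb)
  contract-outer (path s (inj₁ x) (inj₁ y) z) ds es _ _ _ = contract-path s x y z ds es

  module StarPathDecomposition (D′ : Decomposition V′ E′) (noTri : (k : Fin (size D′)) → NotTri (piece D′ k)) where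

    Ix : Set
    Ix = Fin (size D′)

    P : Ix → Piece V′
    P = piece D′

    same-piece : {x y : V′} → E′ x y → (k k′ : Ix) → Covers (P k) x y → Covers (P k′) x y → k ≡ k′
    same-piece xy k k′ cov cov′ with exactlyOnce D′ _ _ xy
    ... | _ , _ , unique = trans (unique k cov) (sym (unique k′ cov′))

    fishEdge : (i : Fin m) (ε : FishEdge) → E′ (gadget i (proj₁ (endpoints ε))) (gadget i (proj₂ (endpoints ε)))
    fishEdge i ⟨ xy ⟩ = fish i (inj₁ xy)

    fishPiece : Fin m → FishEdge → Ix
    fishPiece i ε = proj₁ (exactlyOnce D′ _ _ (fishEdge i ε))

    fishPiece-covers : (i : Fin m) (ε : FishEdge) →
      Covers (P (fishPiece i ε)) (gadget i (proj₁ (endpoints ε))) (gadget i (proj₂ (endpoints ε)))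
    fishPiece-covers i ε = proj₁ (proj₂ (exactlyOnce D′ _ _ (fishEdge i ε)))

    fishPiece-unique : (i : Fin m) (ε : FishEdge) (k : Ix) →
      Covers (P k) (gadget i (proj₁ (endpoints ε))) (gadget i (proj₂ (endpoints ε))) → k ≡ fishPiece i ε
    fishPiece-unique i ε = proj₂ (proj₂ (exactlyOnce D′ _ _ (fishEdge i ε)))

    localPiece : Fin m → Ix → Piece Local
    localPiece i k = mapPiece (view i) (P k)

    localPiece-valid : (i : Fin m) (k : Ix) → ValidLocal (localPiece i k)
    localPiece-valid i k = view-valid i (P k) (noTri k) (distinct D′ k) (inE D′ k)

    afPiece : Fin m → Ix
    afPiece i = fishPiece i ⟨ af ⟩

    afPiece-local : (i : Fin m) → AFPath (localPiece i (afPiece i))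
    afPiece-local i =
      af-forced (localPiece i ∘ fishPiece i) (localPiece-valid i ∘ fishPiece i)
        (λ ε → view-covers⁺ i _ (fishPiece-covers i ε))
        (λ ε ε′ cov → cong (localPiece i) (sym (fishPiece-unique i ε′ (fishPiece i ε) (view-covers⁻ i _ cov))))

    AFShape : Fin m → Piece V′ → Set
    AFShape i p = Σ (Fin n) λ t → IsEnd i t × Σ CoFish λ y →
      p ≡ path (inj₁ t) (sub i) (gadget i a) (gadget i y) ⊎ p ≡ path (gadget i y) (gadget i a) (sub i) (inj₁ t)

    private
      path-injective : {A : Set} {s x y z s′ x′ y′ z′ : A} → path s x y z ≡ path s′ x′ y′ z′ →
        s ≡ s′ × x ≡ x′ × y ≡ y′ × z ≡ z′
      path-injective refl = refl , refl , refl , refl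

      outside-neighbour : (i : Fin m) (s : V′) → E′ s (sub i) → view i s ≡ outside →
        Σ (Fin n) λ t → IsEnd i t × s ≡ inj₁ t
      outside-neighbour i s sw eq with sub-neighbours (E′-sym sw)
      ... | inj₁ refl        = end₁ i , inj₁ refl , refl
      ... | inj₂ (inj₁ refl) = end₂ i , inj₂ refl , refl
      ... | inj₂ (inj₂ refl) with trans (sym (view-gadget i a)) eq
      ...   | ()

    AFPath⇒AFShape : (i : Fin m) (p : Piece V′) → EdgesIn E′ p → AFPath (mapPiece (view i) p) → AFShape i p
    AFPath⇒AFShape i (star _ _ _ _) _ (_ , inj₁ ())
    AFPath⇒AFShape i (star _ _ _ _) _ (_ , inj₂ ())
    AFPath⇒AFShape i (tri _ _ _)    _ (_ , inj₁ ())
    AFPath⇒AFShape i (tri _ _ _)    _ (_ , inj₂ ())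
    AFPath⇒AFShape i (path s x y z) (sx ∷ _) (w , inj₁ eq) with path-injective eq
    ... | s-out , x-f , y-a , z-w with view⁻¹ i x x-f | view⁻¹ i y y-a | view⁻¹ i z z-w
    ...   | refl | refl | refl with outside-neighbour i s sx s-out
    ...     | t , end , refl = t , end , w , inj₁ refl
    AFPath⇒AFShape i (path s x y z) (_ ∷ _ ∷ yz ∷ []) (w , inj₂ eq) with path-injective eq
    ... | s-w , x-a , y-f , z-out with view⁻¹ i s s-w | view⁻¹ i x x-a | view⁻¹ i y y-f
    ...   | refl | refl | refl with outside-neighbour i z (E′-sym yz) z-out
    ...     | t , end , refl = t , end , w , inj₂ refl

    -- abstract, so that type checking never unfolds the exhaustive search behind it
    abstract
      afShape : (i : Fin m) → AFShape i (P (afPiece i))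
      afShape i = AFPath⇒AFShape i (P (afPiece i)) (inE D′ (afPiece i)) (afPiece-local i)

    -- the end of the i-th edge of M through which the af path leaves the gadget
    entry : Fin m → Fin n
    entry i = proj₁ (afShape i)

    entry-IsEnd : (i : Fin m) → IsEnd i (entry i)
    entry-IsEnd i = proj₁ (proj₂ (afShape i))

    afPiece-old : (i : Fin m) {s : Fin n} {z : V′} → Covers (P (afPiece i)) (inj₁ s) z → z ≡ sub i × s ≡ entry i
    afPiece-old i cov with afShape i
    ... | t , _ , y , inj₁ eq = forward (subst (λ p → Covers p _ _) eq cov)
      where
      forward : {s : Fin n} {z : V′} → Covers (path (inj₁ t) (sub i) (gadget i a) (gadget i y)) (inj₁ s) z →
        z ≡ sub i × s ≡ t
      forward (here (inj₁ (refl , refl)))           = refl , refl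
      forward (here (inj₂ (_ , ())))
      forward (there (here (inj₁ (() , _))))
      forward (there (here (inj₂ (_ , ()))))
      forward (there (there (here (inj₁ (() , _)))))
      forward (there (there (here (inj₂ (_ , ())))))
    ... | t , _ , y , inj₂ eq = backward (subst (λ p → Covers p _ _) eq cov)
      where
      backward : {s : Fin n} {z : V′} → Covers (path (gadget i y) (gadget i a) (sub i) (inj₁ t)) (inj₁ s) z →
        z ≡ sub i × s ≡ t
      backward (here (inj₁ (() , _)))
      backward (here (inj₂ (_ , ())))
      backward (there (here (inj₁ (() , _))))
      backward (there (here (inj₂ (_ , ()))))
      backward (there (there (here (inj₁ (() , _)))))
      backward (there (there (here (inj₂ (refl , refl))))) = refl , refl

    afPiece-entry : (i : Fin m) → Covers (P (afPiece i)) (inj₁ (entry i)) (sub i)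
    afPiece-entry i with afShape i
    ... | t , _ , y , inj₁ eq = subst (λ p → Covers p _ _) (sym eq) (here (inj₁ (refl , refl)))
    ... | t , _ , y , inj₂ eq = subst (λ p → Covers p _ _) (sym eq) (there (there (here (inj₂ (refl , refl)))))

    afPiece-not-outer : (i : Fin m) → outerᵇ (P (afPiece i)) ≡ false
    afPiece-not-outer i with afShape i
    ... | _ , _ , _ , inj₁ eq = cong outerᵇ eq
    ... | _ , _ , _ , inj₂ eq = cong outerᵇ eq

    mixed⇒afPiece : (i : Fin m) (k : Ix) {x y : CoFish} {s : Fin n} {z : V′} →
      Covers (P k) (gadget i x) (gadget i y) → Covers (P k) (inj₁ s) z → k ≡ afPiece i
    mixed⇒afPiece i k {x} {y} gadget-edge old-edge =
      fishPiece-unique i ⟨ af ⟩ k (view-covers⁻ i (P k)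
        (valid-mixed⇒covers-af (localPiece i k) (localPiece-valid i k) inside-edge touches))
      where
      inside-edge : HasInsideEdge (localPiece i k)
      inside-edge = Any.map (λ { (inj₁ (p , q)) → (x , p) , (y , q) ; (inj₂ (p , q)) → (y , p) , (x , q) })
                      (view-covers⁺ i (P k) gadget-edge)
      touches : TouchesOutside (localPiece i k)
      touches = subst (Any _) (sym (edges-mapPiece (view i) (P k)))
        (Anyₚ.map⁺ (Any.map (λ { (inj₁ (refl , _)) → inj₁ refl ; (inj₂ (_ , refl)) → inj₂ refl }) old-edge))

    not-outer⇒afPiece : (k : Ix) {s : Fin n} {z : V′} → Covers (P k) (inj₁ s) z → outerᵇ (P k) ≡ false →
      Σ (Fin m) λ i → z ≡ sub i × s ≡ entry i
    not-outer⇒afPiece k cov not-outer with not-outer⇒gadget-edge (P k) (inE D′ k) not-outer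
    ... | i , _ , _ , gadget-edge with mixed⇒afPiece i k gadget-edge cov
    ...   | refl = i , afPiece-old i cov

    old-edge⇒outer : (k : Ix) {u v : Fin n} → Covers (P k) (inj₁ u) (inj₁ v) → T (outerᵇ (P k))
    old-edge⇒outer k cov with outerᵇ (P k) in eq
    ... | true  = tt
    ... | false with not-outer⇒afPiece k cov eq
    ...   | _ , () , _

    free-end⇒outer : (i : Fin m) (k : Ix) {t : Fin n} → Covers (P k) (inj₁ t) (sub i) → t ≢ entry i →
      T (outerᵇ (P k))
    free-end⇒outer i k cov t≢entry with outerᵇ (P k) in eq
    ... | true  = tt
    ... | false with not-outer⇒afPiece k cov eq
    ...   | _ , refl , t≡entry = ⊥-elim (t≢entry t≡entry)

    outer⇒not-both-ends : (k : Ix) → T (outerᵇ (P k)) → (i : Fin m) →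
      ¬ (Covers (P k) (inj₁ (end₁ i)) (sub i) × Covers (P k) (inj₁ (end₂ i)) (sub i))
    outer⇒not-both-ends k outer i (cov₁ , cov₂) = subst T (trans (cong (outerᵇ ∘ P) k≡af) (afPiece-not-outer i)) outer
      where
      af-covers : {t : Fin n} → entry i ≡ t → Covers (P (afPiece i)) (inj₁ t) (sub i)
      af-covers eq = subst (λ t → Covers (P (afPiece i)) (inj₁ t) (sub i)) eq (afPiece-entry i)
      k≡af : k ≡ afPiece i
      k≡af with entry-IsEnd i
      ... | inj₁ eq = same-piece (subˡ i) k (afPiece i) cov₁ (af-covers eq)
      ... | inj₂ eq = same-piece (subʳ' i) k (afPiece i) cov₂ (af-covers eq)

    Outer : Set
    Outer = Σ Ix (T ∘ outerᵇ ∘ P)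

    outer-≡ : {o o′ : Outer} → proj₁ o ≡ proj₁ o′ → o ≡ o′
    outer-≡ eq = Σ-≡,≡→≡ (eq , T-irrelevant _ _)

    contraction : (o : Outer) → Contraction (P (proj₁ o)) (contractPiece (P (proj₁ o)))
    contraction (k , outer) =
      contract-outer (P k) (distinct D′ k) (inE D′ k) (noTri k) outer (outer⇒not-both-ends k outer)

    Ĉ : Outer → Piece (Fin n)
    Ĉ o = contractPiece (P (proj₁ o))

    contracted-old : (o : Outer) {u v : Fin n} → Covers (P (proj₁ o)) (inj₁ u) (inj₁ v) → Covers (Ĉ o) u v
    contracted-old o = Any-transport Collapses-old (Contraction.images (contraction o))

    contracted-sub : (o : Outer) {t : Fin n} {i : Fin m} → Covers (P (proj₁ o)) (inj₁ t) (sub i) →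
      Covers (Ĉ o) t (otherEnd i t)
    contracted-sub o = Any-transport Collapses-sub (Contraction.images (contraction o))

    contracted⁻¹ : (o : Outer) {u v : Fin n} → Covers (Ĉ o) u v →
      Covers (P (proj₁ o)) (inj₁ u) (inj₁ v) ⊎
      Σ (Fin m) λ i → SameEdge (M i) u v × (Covers (P (proj₁ o)) (inj₁ u) (sub i) ⊎ Covers (P (proj₁ o)) (inj₁ v) (sub i))
    contracted⁻¹ o cov = split (Any-transport Collapses-preimage (Contraction.preimages (contraction o)) cov)
      where
      split : {εs : List (V′ × V′)} {u v : Fin n} → Any (λ ε → Preimage ε u v) εs →
        Any (λ ε → SameEdge ε (inj₁ u) (inj₁ v)) εs ⊎
        Σ (Fin m) λ i → SameEdge (M i) u v ×
          (Any (λ ε → SameEdge ε (inj₁ u) (sub i)) εs ⊎ Any (λ ε → SameEdge ε (inj₁ v) (sub i)) εs)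
      split (here (inj₁ se))                  = inj₁ (here se)
      split (here (inj₂ (i , se , inj₁ se′))) = inj₂ (i , se , inj₁ (here se′))
      split (here (inj₂ (i , se , inj₂ se′))) = inj₂ (i , se , inj₂ (here se′))
      split (there cov) with split cov
      ... | inj₁ cov′              = inj₁ (there cov′)
      ... | inj₂ (i , se , inj₁ sb) = inj₂ (i , se , inj₁ (there sb))
      ... | inj₂ (i , se , inj₂ sb) = inj₂ (i , se , inj₂ (there sb))

    UniqueContraction : Fin n → Fin n → Set
    UniqueContraction u v = Σ Outer λ o → Covers (Ĉ o) u v × ((o′ : Outer) → Covers (Ĉ o′) u v → o′ ≡ o)

    unique-old : (u v : Fin n) → E u v → ¬ InM u v → UniqueContraction u v
    unique-old u v uv notM = (k , outer) , contracted-old (k , outer) cov , unique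
      where
      uv′ : E′ (inj₁ u) (inj₁ v)
      uv′ = old uv (λ i se → notM (i , se))
      k = proj₁ (exactlyOnce D′ _ _ uv′)
      cov = proj₁ (proj₂ (exactlyOnce D′ _ _ uv′))
      outer = old-edge⇒outer k cov
      unique : (o : Outer) → Covers (Ĉ o) u v → o ≡ (k , outer)
      unique o cov′ with contracted⁻¹ o cov′
      ... | inj₁ cov″          = outer-≡ (proj₂ (proj₂ (exactlyOnce D′ _ _ uv′)) (proj₁ o) cov″)
      ... | inj₂ (i , se , _) = ⊥-elim (notM (i , se))

    -- An edge of M comes from the piece covering its free subdivision edge, i.e. the one not
    -- used by the af path.
    unique-M : (u v : Fin n) → InM u v → UniqueContraction u v
    unique-M u v (i , se) = (k , outer) , orient (M-orientations free-edge se) , unique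
      where
      t = entry i
      free = otherEnd i t
      free-edge : SameEdge (M i) free t
      free-edge = SameEdge-sym (otherEnd-SameEdge i (entry-IsEnd i))
      free-end : IsEnd i free
      free-end = proj₁ (M-IsEnd free-edge)
      free≢entry : free ≢ t
      free≢entry = M-distinct free-edge
      k = proj₁ (exactlyOnce D′ _ _ (E′-end i free-end))
      cov = proj₁ (proj₂ (exactlyOnce D′ _ _ (E′-end i free-end)))
      outer = free-end⇒outer i k cov free≢entry
      covers-free : Covers (contractPiece (P k)) free t
      covers-free = subst (Covers (contractPiece (P k)) free)
        (sym (IsEnd-other i (entry-IsEnd i) free-end (free≢entry ∘ sym))) (contracted-sub (k , outer) cov)
      orient : (free ≡ u × t ≡ v) ⊎ (free ≡ v × t ≡ u) → Covers (contractPiece (P k)) u v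
      orient (inj₁ (refl , refl)) = covers-free
      orient (inj₂ (refl , refl)) = Covers-sym covers-free
      via-sub : (o : Outer) {x : Fin n} → IsEnd i x → Covers (P (proj₁ o)) (inj₁ x) (sub i) → o ≡ (k , outer)
      via-sub (k′ , outer′) {x} x-end cov′ with x Fin.≟ t
      ... | yes refl = ⊥-elim (subst T (trans (cong (outerᵇ ∘ P) k′≡af) (afPiece-not-outer i)) outer′)
        where
        k′≡af : k′ ≡ afPiece i
        k′≡af = same-piece (Covers⇒edge E′-sym (P k′) (inE D′ k′) cov′) k′ (afPiece i) cov′ (afPiece-entry i)
      ... | no x≢t = outer-≡ (proj₂ (proj₂ (exactlyOnce D′ _ _ (E′-end i free-end))) k′
                      (subst (λ y → Covers (P k′) (inj₁ y) (sub i)) (IsEnd-other i x-end (entry-IsEnd i) x≢t) cov′))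
      unique : (o : Outer) → Covers (Ĉ o) u v → o ≡ (k , outer)
      unique o cov′ with contracted⁻¹ o cov′
      ... | inj₁ old-edge = ⊥-elim (proj₂ (E′-old⁻¹ (Covers⇒edge E′-sym (P (proj₁ o)) (inE D′ (proj₁ o)) old-edge)) i se)
      ... | inj₂ (j , se′ , sub-edge) with M-unique se′ se
      ...   | refl with sub-edge
      ...     | inj₁ cov-u = via-sub o (proj₁ (M-IsEnd se)) cov-u
      ...     | inj₂ cov-v = via-sub o (proj₂ (M-IsEnd se)) cov-v

    contractedDecomposition : HasValidDecomposition (Fin n) E InM
    contractedDecomposition =
      enumerate enumeration D , λ j → Contraction.valid (contraction (Inverse.to (proj₂ enumeration) j))
      where
      enumeration : Enumeration Outer
      enumeration = Enumeration-filter (size D′) (outerᵇ ∘ P)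
      D : IndexedDecomposition (Fin n) E Outer
      D = record
        { part            = Ĉ
        ; partDistinct    = Contraction.vertices-distinct ∘ contraction
        ; partInE         = Contraction.edges-in-G ∘ contraction
        ; partExactlyOnce = λ u v uv → case InM-dec u v of λ where
            (yes inM) → unique-M u v inM
            (no notM) → unique-old u v uv notM
        }

  -- Expanding the edges of M

  -- the neighbour of the old vertex x on the way to y in G′
  toward : Fin n → Fin n → V′
  toward x y with InM-dec x y
  ... | yes (i , _) = sub i
  ... | no _        = inj₁ y

  data Toward (x y : Fin n) : V′ → Set where
    direct : ¬ InM x y → Toward x y (inj₁ y)
    via    : (i : Fin m) → SameEdge (M i) x y → Toward x y (sub i)

  toward-view : (x y : Fin n) → Toward x y (toward x y)
  toward-view x y with InM-dec x y
  ... | yes (i , se) = via i se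
  ... | no notM      = direct notM

  toward-direct : {x y : Fin n} → ¬ InM x y → toward x y ≡ inj₁ y
  toward-direct {x} {y} notM = go (toward-view x y)
    where
    go : {w : V′} → Toward x y w → w ≡ inj₁ y
    go (direct _) = refl
    go (via i se) = ⊥-elim (notM (i , se))

  toward-M : {i : Fin m} {x y : Fin n} → SameEdge (M i) x y → toward x y ≡ sub i
  toward-M {i} {x} {y} se = go (toward-view x y)
    where
    go : {w : V′} → Toward x y w → w ≡ sub i
    go (direct notM) = ⊥-elim (notM (i , se))
    go (via j se′) with M-unique se′ se
    ... | refl = refl

  toward-edge : {x y : Fin n} → T (adj x y) → E′ (inj₁ x) (toward x y)
  toward-edge {x} {y} xy = go (toward-view x y)
    where
    go : {w : V′} → Toward x y w → E′ (inj₁ x) w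
    go (direct notM) = old xy (λ i se → notM (i , se))
    go (via i se)    = E′-end i (proj₁ (M-IsEnd se))

  toward-≢-self : {x y : Fin n} → T (adj x y) → toward x y ≢ inj₁ x
  toward-≢-self {x} {y} xy = go (toward-view x y)
    where
    go : {w : V′} → Toward x y w → w ≢ inj₁ x
    go (direct _) refl = adj-irreflexive xy refl
    go (via _ _)  ()

  toward-≢-old : {x y z : Fin n} → z ≢ y → toward x y ≢ inj₁ z
  toward-≢-old {x} {y} z≢y = go (toward-view x y)
    where
    go : {w : V′} → Toward x y w → w ≢ inj₁ _
    go (direct _) refl = z≢y refl
    go (via _ _)  ()

  toward-≡ : {x y x′ y′ : Fin n} → toward x y ≡ toward x′ y′ →
    (¬ InM x y × ¬ InM x′ y′ × y ≡ y′) ⊎ Σ (Fin m) λ i → SameEdge (M i) x y × SameEdge (M i) x′ y′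
  toward-≡ {x} {y} {x′} {y′} = go (toward-view x y) (toward-view x′ y′)
    where
    go : {w w′ : V′} → Toward x y w → Toward x′ y′ w′ → w ≡ w′ →
      (¬ InM x y × ¬ InM x′ y′ × y ≡ y′) ⊎ Σ (Fin m) λ i → SameEdge (M i) x y × SameEdge (M i) x′ y′
    go (direct notM) (direct notM′) refl = inj₁ (notM , notM′ , refl)
    go (direct _)    (via _ _)      ()
    go (via _ _)     (direct _)     ()
    go (via i se)    (via .i se′)   refl = inj₂ (i , se , se′)

  toward-injective : {x y y′ : Fin n} → y ≢ y′ → toward x y ≢ toward x y′
  toward-injective y≢y′ eq with toward-≡ eq
  ... | inj₁ (_ , _ , y≡y′) = y≢y′ y≡y′
  ... | inj₂ (_ , se , se′) with M-orientations se se′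
  ...   | inj₁ (_ , y≡y′)  = y≢y′ y≡y′
  ...   | inj₂ (_ , y≡x)   = M-distinct se (sym y≡x)

  -- the edge ε̂ = x–y of G is represented in G′ by the edge x–(toward x y)
  Expands : Fin n × Fin n → V′ × V′ → Set
  Expands ε̂ ε = Σ (Fin n) λ x → Σ (Fin n) λ y → SameEdge ε̂ x y ×
    (ε ≡ (inj₁ x , toward x y) ⊎ ε ≡ (toward x y , inj₁ x))

  expands : {x y : Fin n} {ε̂ : Fin n × Fin n} → SameEdge ε̂ x y → Expands ε̂ (inj₁ x , toward x y)
  expands {x} {y} se = x , y , se , inj₁ refl

  expands′ : {x y : Fin n} {ε̂ : Fin n × Fin n} → SameEdge ε̂ x y → Expands ε̂ (toward x y , inj₁ x)
  expands′ {x} {y} se = x , y , se , inj₂ refl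

  expands-direct : {x y : Fin n} {ε̂ : Fin n × Fin n} → ¬ InM x y → SameEdge ε̂ x y → Expands ε̂ (inj₁ x , inj₁ y)
  expands-direct {x} notM se = subst (λ w → Expands _ (inj₁ x , w)) (toward-direct notM) (expands se)

  private
    expand-direct : {x y u v : Fin n} → SameEdge (x , y) u v → ¬ InM u v →
      SameEdge (inj₁ x , toward x y) (inj₁ u) (inj₁ v)
    expand-direct (inj₁ (refl , refl)) notM rewrite toward-direct notM = inj₁ (refl , refl)
    expand-direct (inj₂ (refl , refl)) notM rewrite toward-direct (notM ∘ InM-sym) = inj₂ (refl , refl)

    expand-direct⁻¹ : {x y u v : Fin n} → SameEdge (inj₁ x , toward x y) (inj₁ u) (inj₁ v) → SameEdge (x , y) u v
    expand-direct⁻¹ {x} {y} = go (toward-view x y)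
      where
      go : {w : V′} {u v : Fin n} → Toward x y w → SameEdge (inj₁ x , w) (inj₁ u) (inj₁ v) → SameEdge (x , y) u v
      go (direct _) (inj₁ (refl , refl)) = inj₁ (refl , refl)
      go (direct _) (inj₂ (refl , refl)) = inj₂ (refl , refl)
      go (via _ _)  (inj₁ (_ , ()))
      go (via _ _)  (inj₂ (_ , ()))

    expand-sub⁻¹ : {x y t : Fin n} {i : Fin m} → SameEdge (inj₁ x , toward x y) (inj₁ t) (sub i) →
      SameEdge (x , y) (end₁ i) (end₂ i)
    expand-sub⁻¹ {x} {y} = go (toward-view x y)
      where
      go : {w : V′} {t : Fin n} {i : Fin m} → Toward x y w → SameEdge (inj₁ x , w) (inj₁ t) (sub i) →
        SameEdge (x , y) (end₁ i) (end₂ i)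
      go (direct _) (inj₁ (_ , ()))
      go (direct _) (inj₂ (() , _))
      go (via _ se) (inj₁ (_ , refl)) = SameEdge-converse se
      go (via _ _)  (inj₂ (() , _))

    expand-sub : {x y : Fin n} {i : Fin m} → SameEdge (x , y) (end₁ i) (end₂ i) →
      SameEdge (inj₁ x , toward x y) (inj₁ (end₁ i)) (sub i) ⊎ SameEdge (inj₁ x , toward x y) (inj₁ (end₂ i)) (sub i)
    expand-sub {i = i} (inj₁ (refl , refl)) rewrite toward-M {i} (inj₁ (refl , refl)) = inj₁ (inj₁ (refl , refl))
    expand-sub {i = i} (inj₂ (refl , refl)) rewrite toward-M {i} (inj₂ (refl , refl)) = inj₂ (inj₁ (refl , refl))

  Expands-direct : {ε̂ : Fin n × Fin n} {ε : V′ × V′} {u v : Fin n} → Expands ε̂ ε → SameEdge ε̂ u v → ¬ InM u v →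
    SameEdge ε (inj₁ u) (inj₁ v)
  Expands-direct (_ , _ , se , inj₁ refl) se′ notM = expand-direct (SameEdge-trans (SameEdge-converse se) se′) notM
  Expands-direct (_ , _ , se , inj₂ refl) se′ notM =
    SameEdge-swap (expand-direct (SameEdge-trans (SameEdge-converse se) se′) notM)

  Expands-direct⁻¹ : {ε̂ : Fin n × Fin n} {ε : V′ × V′} {u v : Fin n} → Expands ε̂ ε →
    SameEdge ε (inj₁ u) (inj₁ v) → SameEdge ε̂ u v
  Expands-direct⁻¹ (_ , _ , se , inj₁ refl) se′ = SameEdge-trans se (expand-direct⁻¹ se′)
  Expands-direct⁻¹ (_ , _ , se , inj₂ refl) se′ = SameEdge-trans se (expand-direct⁻¹ (SameEdge-swap se′))

  Expands-sub : {ε̂ : Fin n × Fin n} {ε : V′ × V′} {i : Fin m} → Expands ε̂ ε → SameEdge ε̂ (end₁ i) (end₂ i) →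
    SameEdge ε (inj₁ (end₁ i)) (sub i) ⊎ SameEdge ε (inj₁ (end₂ i)) (sub i)
  Expands-sub (_ , _ , se , inj₁ refl) se′ = expand-sub (SameEdge-trans (SameEdge-converse se) se′)
  Expands-sub (_ , _ , se , inj₂ refl) se′ with expand-sub (SameEdge-trans (SameEdge-converse se) se′)
  ... | inj₁ se″ = inj₁ (SameEdge-swap se″)
  ... | inj₂ se″ = inj₂ (SameEdge-swap se″)

  Expands-sub⁻¹ : {ε̂ : Fin n × Fin n} {ε : V′ × V′} {t : Fin n} {i : Fin m} → Expands ε̂ ε →
    SameEdge ε (inj₁ t) (sub i) → SameEdge ε̂ (end₁ i) (end₂ i)
  Expands-sub⁻¹ (_ , _ , se , inj₁ refl) se′ = SameEdge-trans se (expand-sub⁻¹ se′)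
  Expands-sub⁻¹ (_ , _ , se , inj₂ refl) se′ = SameEdge-trans se (expand-sub⁻¹ (SameEdge-swap se′))

  Expands-not-gadget : {ε̂ : Fin n × Fin n} {ε : V′ × V′} {s t : Fin m × CoFish} → Expands ε̂ ε →
    ¬ SameEdge ε (inj₂ s) (inj₂ t)
  Expands-not-gadget (_ , _ , _ , inj₁ refl) (inj₁ (() , _))
  Expands-not-gadget (_ , _ , _ , inj₁ refl) (inj₂ (() , _))
  Expands-not-gadget (_ , _ , _ , inj₂ refl) (inj₁ (_ , ()))
  Expands-not-gadget (_ , _ , _ , inj₂ refl) (inj₂ (_ , ()))

  expandPath : Fin n → Fin n → Fin n → Fin n → Piece V′
  expandPath s x y z = path (toward x s) (inj₁ x) (inj₁ y) (toward y z)

  -- A valid triangle has an edge outside M, which becomes the middle edge of a path whose two ends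
  -- point to the third vertex; one of the two edges there is in M, so the ends are distinct.
  openTriangle : (x y z : Fin n) → Dec (InM z x) → Dec (InM x y) → Piece V′
  openTriangle x y z (no _)  _       = expandPath y x z y
  openTriangle x y z (yes _) (no _)  = expandPath z x y z
  openTriangle x y z (yes _) (yes _) = expandPath x y z x

  expandPiece : Piece (Fin n) → Piece V′
  expandPiece (star x y z w) = star (inj₁ x) (toward x y) (toward x z) (toward x w)
  expandPiece (path s x y z) = expandPath s x y z
  expandPiece (tri x y z)    = openTriangle x y z (InM-dec z x) (InM-dec x y)

  record Expansion (q : Piece (Fin n)) (p : Piece V′) : Set where
    field
      vertices-distinct : AllPairs _≢_ (verts p)
      edges-in-G′       : EdgesIn E′ p
      not-tri           : NotTri p
      images            : All (λ ε̂ → Any (Expands ε̂) (edges p)) (edges q)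
      preimages         : All (λ ε → Any (λ ε̂ → Expands ε̂ ε) (edges q)) (edges p)
      not-both-ends     : NotBothEnds p

  toward-ends-≢ : {s x y z : Fin n} → x ≢ y → x ≢ z → (¬ InM x s → ¬ InM y z → s ≢ z) → toward x s ≢ toward y z
  toward-ends-≢ x≢y x≢z direct-ends eq with toward-≡ eq
  ... | inj₁ (xs∉M , yz∉M , s≡z) = direct-ends xs∉M yz∉M s≡z
  ... | inj₂ (_ , se , se′) with M-orientations se se′
  ...   | inj₁ (x≡y , _) = x≢y x≡y
  ...   | inj₂ (x≡z , _) = x≢z x≡z

  expandPath-ok : (s x y z : Fin n) → T (adj x s) → T (adj x y) → T (adj y z) → ¬ InM x y →
    s ≢ y → z ≢ x → (¬ InM x s → ¬ InM y z → s ≢ z) →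
    AllPairs _≢_ (verts (expandPath s x y z)) × EdgesIn E′ (expandPath s x y z) × NotBothEnds (expandPath s x y z)
  expandPath-ok s x y z xs xy yz notM s≢y z≢x direct-ends =
    ((toward-≢-self xs ∷ toward-≢-old (s≢y ∘ sym) ∷ ends≢ ∷ []) ∷
     ((adj-irreflexive xy ∘ inj₁-injective) ∷ ((toward-≢-old (z≢x ∘ sym)) ∘ sym) ∷ []) ∷
     ((toward-≢-self yz ∘ sym) ∷ []) ∷ [] ∷ []) ,
    (E′-sym (toward-edge xs) ∷ old xy (λ i se → notM (i , se)) ∷ toward-edge yz ∷ []) ,
    not-both
    where
    ends≢ : toward x s ≢ toward y z
    ends≢ = toward-ends-≢ (adj-irreflexive xy) (z≢x ∘ sym) direct-ends
    at-end : {t : Fin n} {i : Fin m} → Covers (expandPath s x y z) (inj₁ t) (sub i) →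
      (t ≡ x × toward x s ≡ sub i) ⊎ (t ≡ y × toward y z ≡ sub i)
    at-end (here (inj₁ (_ , ())))
    at-end (here (inj₂ (p , q)))                 = inj₁ (sym (inj₁-injective q) , p)
    at-end (there (here (inj₁ (_ , ()))))
    at-end (there (here (inj₂ (() , _))))
    at-end (there (there (here (inj₁ (p , q))))) = inj₂ (sym (inj₁-injective p) , q)
    at-end (there (there (here (inj₂ (() , _)))))
    not-both : NotBothEnds (expandPath s x y z)
    not-both i (cov₁ , cov₂) with at-end cov₁ | at-end cov₂
    ... | inj₁ (p , _) | inj₁ (q , _) = end₁≢end₂ i (trans p (sym q))
    ... | inj₂ (p , _) | inj₂ (q , _) = end₁≢end₂ i (trans p (sym q))
    ... | inj₁ (_ , p) | inj₂ (_ , q) = ends≢ (trans p (sym q))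
    ... | inj₂ (_ , p) | inj₁ (_ , q) = ends≢ (trans q (sym p))


  expansion-of-path : (s x y z : Fin n) → AllPairs _≢_ (verts (expandPath s x y z)) × EdgesIn E′ (expandPath s x y z) ×
    NotBothEnds (expandPath s x y z) → {q : Piece (Fin n)} →
    All (λ ε̂ → Any (Expands ε̂) (edges (expandPath s x y z))) (edges q) →
    All (λ ε → Any (λ ε̂ → Expands ε̂ ε) (edges q)) (edges (expandPath s x y z)) → Expansion q (expandPath s x y z)
  expansion-of-path s x y z (dist , es , not-both) images preimages = record
    { vertices-distinct = dist ; edges-in-G′ = es ; not-tri = tt ; images = images ; preimages = preimages
    ; not-both-ends = not-both }

  expand-star : (x y z w : Fin n) → AllPairs _≢_ (verts (star x y z w)) → EdgesIn E (star x y z w) →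
    Expansion (star x y z w) (expandPiece (star x y z w))
  expand-star x y z w (_ ∷ (y≢z ∷ y≢w ∷ []) ∷ (z≢w ∷ []) ∷ [] ∷ []) (xy ∷ xz ∷ xw ∷ []) = record
    { vertices-distinct =
        ((toward-≢-self xy ∘ sym) ∷ (toward-≢-self xz ∘ sym) ∷ (toward-≢-self xw ∘ sym) ∷ []) ∷
        (toward-injective y≢z ∷ toward-injective y≢w ∷ []) ∷ (toward-injective z≢w ∷ []) ∷ [] ∷ []
    ; edges-in-G′   = toward-edge xy ∷ toward-edge xz ∷ toward-edge xw ∷ []
    ; not-tri       = tt
    ; images        = here (expands (inj₁ (refl , refl))) ∷ there (here (expands (inj₁ (refl , refl)))) ∷
                      there (there (here (expands (inj₁ (refl , refl))))) ∷ []
    ; preimages     = here (expands (inj₁ (refl , refl))) ∷ there (here (expands (inj₁ (refl , refl)))) ∷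
                      there (there (here (expands (inj₁ (refl , refl))))) ∷ []
    ; not-both-ends = λ i (cov₁ , cov₂) → end₁≢end₂ i (trans (centre cov₁) (sym (centre cov₂)))
    }
    where
    centre : {t : Fin n} {i : Fin m} → Covers (star (inj₁ x) (toward x y) (toward x z) (toward x w)) (inj₁ t) (sub i) → t ≡ x
    centre (here (inj₁ (p , _)))                 = sym (inj₁-injective p)
    centre (here (inj₂ (() , _)))
    centre (there (here (inj₁ (p , _))))         = sym (inj₁-injective p)
    centre (there (here (inj₂ (() , _))))
    centre (there (there (here (inj₁ (p , _))))) = sym (inj₁-injective p)
    centre (there (there (here (inj₂ (() , _)))))

  expand-path : (s x y z : Fin n) → AllPairs _≢_ (verts (path s x y z)) → EdgesIn E (path s x y z) → ¬ InM x y →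
    Expansion (path s x y z) (expandPiece (path s x y z))
  expand-path s x y z ((_ ∷ s≢y ∷ s≢z ∷ []) ∷ (_ ∷ x≢z ∷ []) ∷ _) (sx ∷ xy ∷ yz ∷ []) notM =
    expansion-of-path s x y z (expandPath-ok s x y z (adj-symmetric sx) xy yz notM s≢y (x≢z ∘ sym) (λ _ _ → s≢z))
      (here (expands′ (inj₂ (refl , refl))) ∷ there (here (expands-direct notM (inj₁ (refl , refl)))) ∷
       there (there (here (expands (inj₁ (refl , refl))))) ∷ [])
      (here (expands′ (inj₂ (refl , refl))) ∷ there (here (expands-direct notM (inj₁ (refl , refl)))) ∷
       there (there (here (expands (inj₁ (refl , refl))))) ∷ [])

  expand-triangle : (x y z : Fin n) → AllPairs _≢_ (verts (tri x y z)) → EdgesIn E (tri x y z) →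
    ValidPiece InM (tri x y z) → (zx? : Dec (InM z x)) (xy? : Dec (InM x y)) →
    Expansion (tri x y z) (openTriangle x y z zx? xy?)
  expand-triangle x y z ((x≢y ∷ x≢z ∷ []) ∷ (y≢z ∷ []) ∷ [] ∷ []) (xy ∷ yz ∷ zx ∷ []) (some-M , _) (no zx∉M) _ =
    expansion-of-path y x z y
      (expandPath-ok y x z y xy (adj-symmetric zx) (adj-symmetric yz) xz∉M y≢z (x≢y ∘ sym)
        (λ xy∉M zy∉M _ → [ xy∉M , [ zy∉M ∘ InM-sym , zx∉M ]′ ]′ some-M))
      (here (expands′ (inj₁ (refl , refl))) ∷ there (there (here (expands (inj₂ (refl , refl))))) ∷
       there (here (expands-direct xz∉M (inj₂ (refl , refl)))) ∷ [])
      (here (expands′ (inj₁ (refl , refl))) ∷ there (there (here (expands-direct xz∉M (inj₂ (refl , refl))))) ∷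
       there (here (expands (inj₂ (refl , refl)))) ∷ [])
    where
    xz∉M : ¬ InM x z
    xz∉M = zx∉M ∘ InM-sym
  expand-triangle x y z ((x≢y ∷ x≢z ∷ []) ∷ (y≢z ∷ []) ∷ [] ∷ []) (xy ∷ yz ∷ zx ∷ []) _ (yes zx∈M) (no xy∉M) =
    expansion-of-path z x y z
      (expandPath-ok z x y z (adj-symmetric zx) xy yz xy∉M (y≢z ∘ sym) (x≢z ∘ sym)
        (λ xz∉M _ _ → xz∉M (InM-sym zx∈M)))
      (there (here (expands-direct xy∉M (inj₁ (refl , refl)))) ∷ there (there (here (expands (inj₁ (refl , refl))))) ∷
       here (expands′ (inj₂ (refl , refl))) ∷ [])
      (there (there (here (expands′ (inj₂ (refl , refl))))) ∷ here (expands-direct xy∉M (inj₁ (refl , refl))) ∷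
       there (here (expands (inj₁ (refl , refl)))) ∷ [])
  expand-triangle x y z ((x≢y ∷ x≢z ∷ []) ∷ (y≢z ∷ []) ∷ [] ∷ []) (xy ∷ yz ∷ zx ∷ []) (_ , not-all-M) (yes zx∈M) (yes xy∈M) =
    expansion-of-path x y z x
      (expandPath-ok x y z x (adj-symmetric xy) yz zx yz∉M x≢z x≢y (λ yx∉M _ _ → yx∉M (InM-sym xy∈M)))
      (here (expands′ (inj₂ (refl , refl))) ∷ there (here (expands-direct yz∉M (inj₁ (refl , refl)))) ∷
       there (there (here (expands (inj₁ (refl , refl))))) ∷ [])
      (here (expands′ (inj₂ (refl , refl))) ∷ there (here (expands-direct yz∉M (inj₁ (refl , refl)))) ∷
       there (there (here (expands (inj₁ (refl , refl))))) ∷ [])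
    where
    yz∉M : ¬ InM y z
    yz∉M yz∈M = not-all-M (xy∈M , yz∈M , zx∈M)

  expand : (q : Piece (Fin n)) → AllPairs _≢_ (verts q) → EdgesIn E q → ValidPiece InM q → Expansion q (expandPiece q)
  expand (star x y z w) ds es _     = expand-star x y z w ds es
  expand (path s x y z) ds es notM  = expand-path s x y z ds es notM
  expand (tri x y z)    ds es valid = expand-triangle x y z ds es valid (InM-dec z x) (InM-dec x y)

  data GadgetPart : Set where
    entryPath abcdPath eStar : GadgetPart

  Enumeration-GadgetPart : Enumeration GadgetPart
  Enumeration-GadgetPart = 3 , mk↔ₛ′ to from to∘from from∘to
    where
    to : Fin 3 → GadgetPart
    to Fin.zero                   = entryPath
    to (Fin.suc Fin.zero)         = abcdPath
    to (Fin.suc (Fin.suc _))      = eStar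
    from : GadgetPart → Fin 3
    from entryPath = Fin.zero
    from abcdPath  = Fin.suc Fin.zero
    from eStar     = Fin.suc (Fin.suc Fin.zero)
    to∘from : ∀ part → to (from part) ≡ part
    to∘from entryPath = refl
    to∘from abcdPath  = refl
    to∘from eStar     = refl
    from∘to : ∀ j → from (to j) ≡ j
    from∘to Fin.zero                        = refl
    from∘to (Fin.suc Fin.zero)              = refl
    from∘to (Fin.suc (Fin.suc Fin.zero))    = refl

  gadgetPiece : Fin m → Fin n → GadgetPart → Piece V′
  gadgetPiece i t entryPath = path (inj₁ t) (sub i) (gadget i a) (gadget i d)
  gadgetPiece i t abcdPath  = path (gadget i a) (gadget i b) (gadget i c) (gadget i d)
  gadgetPiece i t eStar     = star (gadget i e) (gadget i b) (gadget i c) (gadget i d)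

  gadgetPiece-edges : (i : Fin m) (t : Fin n) → IsEnd i t → (part : GadgetPart) → EdgesIn E′ (gadgetPiece i t part)
  gadgetPiece-edges i t end entryPath = E′-end i end ∷ fish i (inj₂ af) ∷ fish i (inj₁ ad) ∷ []
  gadgetPiece-edges i t end abcdPath  = fish i (inj₁ ab) ∷ fish i (inj₁ bc) ∷ fish i (inj₁ cd) ∷ []
  gadgetPiece-edges i t end eStar     = fish i (inj₂ be) ∷ fish i (inj₂ ce) ∷ fish i (inj₂ de) ∷ []

  gadgetPiece-distinct : (i : Fin m) (t : Fin n) (part : GadgetPart) → AllPairs _≢_ (verts (gadgetPiece i t part))
  gadgetPiece-distinct i t entryPath = ((λ ()) ∷ (λ ()) ∷ (λ ()) ∷ []) ∷ ((λ ()) ∷ (λ ()) ∷ []) ∷ ((λ ()) ∷ []) ∷ [] ∷ []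
  gadgetPiece-distinct i t abcdPath  = ((λ ()) ∷ (λ ()) ∷ (λ ()) ∷ []) ∷ ((λ ()) ∷ (λ ()) ∷ []) ∷ ((λ ()) ∷ []) ∷ [] ∷ []
  gadgetPiece-distinct i t eStar     = ((λ ()) ∷ (λ ()) ∷ (λ ()) ∷ []) ∷ ((λ ()) ∷ (λ ()) ∷ []) ∷ ((λ ()) ∷ []) ∷ [] ∷ []

  gadgetPiece-NotTri : (i : Fin m) (t : Fin n) (part : GadgetPart) → NotTri (gadgetPiece i t part)
  gadgetPiece-NotTri i t entryPath = tt
  gadgetPiece-NotTri i t abcdPath  = tt
  gadgetPiece-NotTri i t eStar     = tt

  gadgetPiece-not-old : (i : Fin m) (t : Fin n) (part : GadgetPart) {u v : Fin n} →
    ¬ Covers (gadgetPiece i t part) (inj₁ u) (inj₁ v)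
  gadgetPiece-not-old i t entryPath (here (inj₁ (_ , ())))
  gadgetPiece-not-old i t entryPath (here (inj₂ (_ , ())))
  gadgetPiece-not-old i t entryPath (there (here (inj₁ (() , _))))
  gadgetPiece-not-old i t entryPath (there (here (inj₂ (() , _))))
  gadgetPiece-not-old i t entryPath (there (there (here (inj₁ (() , _)))))
  gadgetPiece-not-old i t entryPath (there (there (here (inj₂ (() , _)))))
  gadgetPiece-not-old i t abcdPath  (here (inj₁ (() , _)))
  gadgetPiece-not-old i t abcdPath  (here (inj₂ (() , _)))
  gadgetPiece-not-old i t abcdPath  (there (here (inj₁ (() , _))))
  gadgetPiece-not-old i t abcdPath  (there (here (inj₂ (() , _))))
  gadgetPiece-not-old i t abcdPath  (there (there (here (inj₁ (() , _)))))
  gadgetPiece-not-old i t abcdPath  (there (there (here (inj₂ (() , _)))))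
  gadgetPiece-not-old i t eStar     (here (inj₁ (() , _)))
  gadgetPiece-not-old i t eStar     (here (inj₂ (() , _)))
  gadgetPiece-not-old i t eStar     (there (here (inj₁ (() , _))))
  gadgetPiece-not-old i t eStar     (there (here (inj₂ (() , _))))
  gadgetPiece-not-old i t eStar     (there (there (here (inj₁ (() , _)))))
  gadgetPiece-not-old i t eStar     (there (there (here (inj₂ (() , _)))))

  gadgetPiece-sub : (i : Fin m) (t : Fin n) (part : GadgetPart) {j : Fin m} {x : Fin n} →
    Covers (gadgetPiece i t part) (inj₁ x) (sub j) → part ≡ entryPath × i ≡ j × x ≡ t
  gadgetPiece-sub i t entryPath (here (inj₁ (p , refl)))             = refl , refl , sym (inj₁-injective p)
  gadgetPiece-sub i t entryPath (here (inj₂ (() , _)))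
  gadgetPiece-sub i t entryPath (there (here (inj₁ (() , _))))
  gadgetPiece-sub i t entryPath (there (here (inj₂ (_ , ()))))
  gadgetPiece-sub i t entryPath (there (there (here (inj₁ (() , _)))))
  gadgetPiece-sub i t entryPath (there (there (here (inj₂ (_ , ())))))
  gadgetPiece-sub i t abcdPath  (here (inj₁ (() , _)))
  gadgetPiece-sub i t abcdPath  (here (inj₂ (_ , ())))
  gadgetPiece-sub i t abcdPath  (there (here (inj₁ (() , _))))
  gadgetPiece-sub i t abcdPath  (there (here (inj₂ (_ , ()))))
  gadgetPiece-sub i t abcdPath  (there (there (here (inj₁ (() , _)))))
  gadgetPiece-sub i t abcdPath  (there (there (here (inj₂ (_ , ())))))
  gadgetPiece-sub i t eStar     (here (inj₁ (() , _)))
  gadgetPiece-sub i t eStar     (here (inj₂ (_ , ())))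
  gadgetPiece-sub i t eStar     (there (here (inj₁ (() , _))))
  gadgetPiece-sub i t eStar     (there (here (inj₂ (_ , ()))))
  gadgetPiece-sub i t eStar     (there (there (here (inj₁ (() , _)))))
  gadgetPiece-sub i t eStar     (there (there (here (inj₂ (_ , ())))))

  fishPart : CoFish → CoFish → GadgetPart
  fishPart a b = abcdPath
  fishPart b a = abcdPath
  fishPart b c = abcdPath
  fishPart c b = abcdPath
  fishPart c d = abcdPath
  fishPart d c = abcdPath
  fishPart b e = eStar
  fishPart e b = eStar
  fishPart c e = eStar
  fishPart e c = eStar
  fishPart d e = eStar
  fishPart e d = eStar
  fishPart _ _ = entryPath

  fishPart-covers : (i : Fin m) (t : Fin n) {x y : CoFish} → CoAdj x y →
    Covers (gadgetPiece i t (fishPart x y)) (gadget i x) (gadget i y)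
  fishPart-covers i t (inj₁ ab) = here (inj₁ (refl , refl))
  fishPart-covers i t (inj₂ ab) = here (inj₂ (refl , refl))
  fishPart-covers i t (inj₁ af) = there (here (inj₂ (refl , refl)))
  fishPart-covers i t (inj₂ af) = there (here (inj₁ (refl , refl)))
  fishPart-covers i t (inj₁ ad) = there (there (here (inj₁ (refl , refl))))
  fishPart-covers i t (inj₂ ad) = there (there (here (inj₂ (refl , refl))))
  fishPart-covers i t (inj₁ bc) = there (here (inj₁ (refl , refl)))
  fishPart-covers i t (inj₂ bc) = there (here (inj₂ (refl , refl)))
  fishPart-covers i t (inj₁ be) = here (inj₂ (refl , refl))
  fishPart-covers i t (inj₂ be) = here (inj₁ (refl , refl))
  fishPart-covers i t (inj₁ cd) = there (there (here (inj₁ (refl , refl))))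
  fishPart-covers i t (inj₂ cd) = there (there (here (inj₂ (refl , refl))))
  fishPart-covers i t (inj₁ ce) = there (here (inj₂ (refl , refl)))
  fishPart-covers i t (inj₂ ce) = there (here (inj₁ (refl , refl)))
  fishPart-covers i t (inj₁ de) = there (there (here (inj₂ (refl , refl))))
  fishPart-covers i t (inj₂ de) = there (there (here (inj₁ (refl , refl))))

  fishPart-unique : (j : Fin m) (t : Fin n) (part : GadgetPart) {i : Fin m} {x y : CoFish} →
    Covers (gadgetPiece j t part) (gadget i x) (gadget i y) → j ≡ i × part ≡ fishPart x y
  fishPart-unique j t entryPath (here (inj₁ (() , _)))
  fishPart-unique j t entryPath (here (inj₂ (() , _)))
  fishPart-unique j t entryPath (there (here (inj₁ (refl , refl))))         = refl , refl
  fishPart-unique j t entryPath (there (here (inj₂ (refl , refl))))         = refl , refl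
  fishPart-unique j t entryPath (there (there (here (inj₁ (refl , refl))))) = refl , refl
  fishPart-unique j t entryPath (there (there (here (inj₂ (refl , refl))))) = refl , refl
  fishPart-unique j t abcdPath  (here (inj₁ (refl , refl)))                 = refl , refl
  fishPart-unique j t abcdPath  (here (inj₂ (refl , refl)))                 = refl , refl
  fishPart-unique j t abcdPath  (there (here (inj₁ (refl , refl))))         = refl , refl
  fishPart-unique j t abcdPath  (there (here (inj₂ (refl , refl))))         = refl , refl
  fishPart-unique j t abcdPath  (there (there (here (inj₁ (refl , refl))))) = refl , refl
  fishPart-unique j t abcdPath  (there (there (here (inj₂ (refl , refl))))) = refl , refl
  fishPart-unique j t eStar     (here (inj₁ (refl , refl)))                 = refl , refl
  fishPart-unique j t eStar     (here (inj₂ (refl , refl)))                 = refl , refl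
  fishPart-unique j t eStar     (there (here (inj₁ (refl , refl))))         = refl , refl
  fishPart-unique j t eStar     (there (here (inj₂ (refl , refl))))         = refl , refl
  fishPart-unique j t eStar     (there (there (here (inj₁ (refl , refl))))) = refl , refl
  fishPart-unique j t eStar     (there (there (here (inj₂ (refl , refl))))) = refl , refl

  module ValidDecomposition (D : Decomposition (Fin n) E) (valid : (k : Fin (size D)) → ValidPiece InM (piece D k)) where

    X̂ : Fin (size D) → Piece V′
    X̂ k = expandPiece (piece D k)

    expansion : (k : Fin (size D)) → Expansion (piece D k) (X̂ k)
    expansion k = expand (piece D k) (distinct D k) (inE D k) (valid k)

    mPiece : Fin m → Fin (size D)
    mPiece i = proj₁ (exactlyOnce D (end₁ i) (end₂ i) (M-edge i))

    mPiece-unique : (i : Fin m) (k : Fin (size D)) → Covers (piece D k) (end₁ i) (end₂ i) → k ≡ mPiece i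
    mPiece-unique i = proj₂ (proj₂ (exactlyOnce D (end₁ i) (end₂ i) (M-edge i)))

    expanded-sub⁻¹ : (k : Fin (size D)) {x : Fin n} {i : Fin m} → Covers (X̂ k) (inj₁ x) (sub i) → k ≡ mPiece i
    expanded-sub⁻¹ k cov = mPiece-unique _ k (Any-transport Expands-sub⁻¹ (Expansion.preimages (expansion k)) cov)

    -- the expanded piece of an edge of M uses exactly one of its subdivision edges
    data EndSplit (i : Fin m) : Set where
      split : (used free : Fin n) → SameEdge (M i) used free → Covers (X̂ (mPiece i)) (inj₁ used) (sub i) → EndSplit i

    endSplit : (i : Fin m) → EndSplit i
    endSplit i with Inverse.from Anyₚ.⊎↔ (Any-transport Expands-sub (Expansion.images (expansion (mPiece i)))
                                                          (proj₁ (proj₂ (exactlyOnce D (end₁ i) (end₂ i) (M-edge i)))))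
    ... | inj₁ cov = split (end₁ i) (end₂ i) (inj₁ (refl , refl)) cov
    ... | inj₂ cov = split (end₂ i) (end₁ i) (inj₂ (refl , refl)) cov

    free : Fin m → Fin n
    free i with endSplit i
    ... | split _ t _ _ = t

    free-IsEnd : (i : Fin m) → IsEnd i (free i)
    free-IsEnd i with endSplit i
    ... | split _ _ se _ = proj₂ (M-IsEnd se)

    free-not-expanded : (i : Fin m) → ¬ Covers (X̂ (mPiece i)) (inj₁ (free i)) (sub i)
    free-not-expanded i with endSplit i
    ... | split _ _ (inj₁ (refl , refl)) cov = λ cov′ → Expansion.not-both-ends (expansion (mPiece i)) i (cov , cov′)
    ... | split _ _ (inj₂ (refl , refl)) cov = λ cov′ → Expansion.not-both-ends (expansion (mPiece i)) i (cov′ , cov)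

    not-expanded⇒free : (i : Fin m) {x : Fin n} → IsEnd i x → ¬ Covers (X̂ (mPiece i)) (inj₁ x) (sub i) → x ≡ free i
    not-expanded⇒free i x-end ¬cov with endSplit i
    ... | split _ _ se cov with IsEnd-cases x-end se
    ...   | inj₁ refl = ⊥-elim (¬cov cov)
    ...   | inj₂ refl = refl

    Ix : Set
    Ix = Fin (size D) ⊎ (Fin m × GadgetPart)

    part : Ix → Piece V′
    part (inj₁ k)        = X̂ k
    part (inj₂ (i , gp)) = gadgetPiece i (free i) gp

    UniqueCover : V′ → V′ → Set
    UniqueCover x y = Σ Ix λ o → Covers (part o) x y × ((o′ : Ix) → Covers (part o′) x y → o′ ≡ o)

    UniqueCover-sym : {x y : V′} → UniqueCover x y → UniqueCover y x
    UniqueCover-sym (o , cov , unique) = o , Covers-sym cov , λ o′ → unique o′ ∘ Covers-sym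

    unique-old : {u v : Fin n} → T (adj u v) → ¬ InM u v → UniqueCover (inj₁ u) (inj₁ v)
    unique-old {u} {v} uv notM = inj₁ k , Any-transport (λ ε se → Expands-direct ε se notM) (Expansion.images (expansion k)) cov , unique
      where
      k = proj₁ (exactlyOnce D u v uv)
      cov = proj₁ (proj₂ (exactlyOnce D u v uv))
      unique : (o : Ix) → Covers (part o) (inj₁ u) (inj₁ v) → o ≡ inj₁ k
      unique (inj₁ k′) cov′ =
        cong inj₁ (proj₂ (proj₂ (exactlyOnce D u v uv)) k′ (Any-transport Expands-direct⁻¹ (Expansion.preimages (expansion k′)) cov′))
      unique (inj₂ (i , gp)) cov′ = ⊥-elim (gadgetPiece-not-old i (free i) gp cov′)

    unique-sub : (i : Fin m) {x : Fin n} → IsEnd i x → UniqueCover (inj₁ x) (sub i)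
    unique-sub i {x} x-end with Covers-dec _≟′_ (X̂ (mPiece i)) (inj₁ x) (sub i)
    ... | yes cov = inj₁ (mPiece i) , cov , unique
      where
      unique : (o : Ix) → Covers (part o) (inj₁ x) (sub i) → o ≡ inj₁ (mPiece i)
      unique (inj₁ k) cov′ = cong inj₁ (expanded-sub⁻¹ k cov′)
      unique (inj₂ (j , gp)) cov′ with gadgetPiece-sub j (free j) gp cov′
      ... | refl , refl , refl = ⊥-elim (free-not-expanded j cov)
    ... | no ¬cov = inj₂ (i , entryPath) , here (inj₁ (cong inj₁ (sym x≡free) , refl)) , unique
      where
      x≡free = not-expanded⇒free i x-end ¬cov
      unique : (o : Ix) → Covers (part o) (inj₁ x) (sub i) → o ≡ inj₂ (i , entryPath)
      unique (inj₁ k) cov′ with expanded-sub⁻¹ k cov′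
      ... | refl = ⊥-elim (¬cov cov′)
      unique (inj₂ (j , gp)) cov′ with gadgetPiece-sub j (free j) gp cov′
      ... | refl , refl , _ = refl

    unique-fish : (i : Fin m) {x y : CoFish} → CoAdj x y → UniqueCover (gadget i x) (gadget i y)
    unique-fish i {x} {y} xy = inj₂ (i , fishPart x y) , fishPart-covers i (free i) xy , unique
      where
      unique : (o : Ix) → Covers (part o) (gadget i x) (gadget i y) → o ≡ inj₂ (i , fishPart x y)
      unique (inj₁ k) cov =
        ⊥-elim (proj₂ (Any.satisfied (Any-transport Expands-not-gadget (Expansion.preimages (expansion k)) cov)))
      unique (inj₂ (j , gp)) cov with fishPart-unique j (free j) gp cov
      ... | refl , refl = refl

    uniqueCover : (x y : V′) → E′ x y → UniqueCover x y
    uniqueCover _ _ (old uv notM) = unique-old uv (λ { (i , se) → notM i se })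
    uniqueCover _ _ (subˡ i)      = unique-sub i (inj₁ refl)
    uniqueCover _ _ (subˡ' i)     = UniqueCover-sym (unique-sub i (inj₁ refl))
    uniqueCover _ _ (subʳ i)      = UniqueCover-sym (unique-sub i (inj₂ refl))
    uniqueCover _ _ (subʳ' i)     = unique-sub i (inj₂ refl)
    uniqueCover _ _ (fish i xy)   = unique-fish i xy

    expandedDecomposition : HasStarPathDecomposition V′ E′
    expandedDecomposition = enumerate enumeration D′ , λ j → not-tri (Inverse.to (proj₂ enumeration) j)
      where
      enumeration : Enumeration Ix
      enumeration = Enumeration-⊎ (Enumeration-Fin (size D)) (Enumeration-× (Enumeration-Fin m) Enumeration-GadgetPart)
      not-tri : (o : Ix) → NotTri (part o)
      not-tri (inj₁ k)        = Expansion.not-tri (expansion k)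
      not-tri (inj₂ (i , gp)) = gadgetPiece-NotTri i (free i) gp
      D′ : IndexedDecomposition V′ E′ Ix
      D′ = record
        { part            = part
        ; partDistinct    = λ { (inj₁ k) → Expansion.vertices-distinct (expansion k)
                              ; (inj₂ (i , gp)) → gadgetPiece-distinct i (free i) gp }
        ; partInE         = λ { (inj₁ k) → Expansion.edges-in-G′ (expansion k)
                              ; (inj₂ (i , gp)) → gadgetPiece-edges i (free i) (free-IsEnd i) gp }
        ; partExactlyOnce = uniqueCover
        }

lemma3 : (n : ℕ) (adj : Fin n → Fin n → Bool) →
    ((u v : Fin n) → adj u v ≡ adj v u) →
    ((v : Fin n) → adj v v ≡ false) →
    Connected (EG adj) →
    Cubic (EG adj) →
    (m : ℕ) (M : Fin m → Fin n × Fin n) →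
    ((i : Fin m) → T (adj (proj₁ (M i)) (proj₂ (M i)))) →
    ((i j : Fin m) → SameEdge (M i) (proj₁ (M j)) (proj₂ (M j)) → i ≡ j) →
    (HasValidDecomposition (Fin n) (EG adj) (MEdge M)
      ⇔ HasStarPathDecomposition (AttV n m) (AttE adj M))
lemma3 n adj adj-sym adj-irrefl _ _ m M M-edge M-injective =
  mk⇔ (λ (D , valid) → ValidDecomposition.expandedDecomposition D valid)
      (λ (D′ , noTri) → StarPathDecomposition.contractedDecomposition D′ noTri)
  where
  open Attachment n adj adj-sym adj-irrefl m M M-edge M-injective
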